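{- Let $\lambda$ be an integer partition and $\gamma=(\gamma_1,\dots,\gamma_k)\in\mathbb{Z}_{\ge0}^k$ with $k\ge1$ and $\gamma_k+1\ge\lambda_1$. Then $$-\frac{g_{(\lambda|\gamma)}(q,t)}{g_{(\gamma_k+1,\lambda|\gamma_1,\ldots,\gamma_{k-1})}(q,t)}=1.$$
   Context: For a partition $\mu$: $|\mu|$ its size, $n(\mu)=\sum_i(i-1)\mu_i$, $m_i(\mu)$ the number of parts equal to $i$. $(\gamma_k+1,\lambda)$ is the partition obtained by prepending the part $\gamma_k+1$. For $\gamma\in\mathbb{Z}_{\ge0}^k$, $\mathrm{inv}(\gamma)=\#\{i<j:\gamma_i>\gamma_j\}$ and $|\gamma|=\sum\gamma_i$; $\mathrm{sort}(\lambda,\gamma)$ is the weakly decreasing rearrangement of the concatenation. $j_{(\lambda|\gamma)}$: let $\lambda_-$ be the weakly increasing rearrangement of $\lambda$, $\nu=(\lambda_-,\gamma)$, boxes $(i,j)$, $1\le j\le\nu_i$; $\ell_\nu(i,j)=\nu_i-j$, $a_\nu(i,j)=\#\{r<i:j\le\nu_r\le\nu_i\}+\#\{r>i:j-1\le\nu_r<\nu_i\}$, $\tilde a_\nu(i,j)=\#\{r<i:j\le\nu_r\le\nu_i\}+\#\{r>i:j\le\nu_r<\nu_i\}$; $j_{(\lambda|\gamma)}(q,t)=\prod_{\square\in\lambda_- }(1-q^{\ell_\nu(\square)}t^{\tilde a_\nu(\square)+1})\prod_{\square\in\gamma}(1-q^{\ell_\nu(\square)+1}t^{a_\nu(\square)+1})$.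 $g_{(\lambda|\gamma)}(q,t)=j_{(\lambda|\gamma)}(q,t^{ -1})\,t^{\mathrm{inv}(\gamma)+n(\mathrm{sort}(\lambda,\gamma))+|\lambda|+|\gamma|}\prod_{i\ge1}\prod_{j=1}^{m_i(\lambda)}(1-t^j)^{ -1}\in\mathbb{Q}(q,t)$. -}

module Defs where

open import Data.Nat as ℕ using (ℕ; zero; suc; _≤_; _<_; _≤ᵇ_; _<ᵇ_; _∸_)
open import Data.Bool using (Bool; true; false; if_then_else_; _∧_)
open import Data.List using (List; []; _∷_; _++_; length; foldr)
open import Data.List.Relation.Unary.All using (All)
open import Data.List.Relation.Unary.Linked using (Linked)
open import Data.Rational using (ℚ; 0ℚ; 1ℚ; _+_; _*_; _-_; -_; _÷_; ≢-nonZero)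
open import Data.Rational.Properties using (_≟_)
open import Relation.Nullary using (yes; no)
open import Data.Product using (_×_)

IsPartition : List ℕ → Set
IsPartition la = Linked (λ a b → b ≤ a) la × All (λ a → 0 < a) la

head0 : List ℕ → ℕ
head0 []      = 0
head0 (x ∷ _) = x

rangeFrom : ℕ → ℕ → List ℕ
rangeFrom a zero    = []
rangeFrom a (suc n) = a ∷ rangeFrom (suc a) n

range : ℕ → List ℕ
range = rangeFrom 0

sumℕ : List ℕ → ℕ
sumℕ = foldr ℕ._+_ 0

prodℚ : List ℚ → ℚ
prodℚ = foldr _*_ 1ℚ

mapL : {A B : Set} → (A → B) → List A → List B
mapL f []       = []
mapL f (x ∷ xs) = f x ∷ mapL f xs

concatMapL : {A B : Set} → (A → List B) → List A → List B
concatMapL f []       = []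
concatMapL f (x ∷ xs) = f x ++ concatMapL f xs

countL : {A : Set} → (A → Bool) → List A → ℕ
countL p []       = 0
countL p (x ∷ xs) = if p x then suc (countL p xs) else countL p xs

nth : List ℕ → ℕ → ℕ
nth []       _       = 0
nth (x ∷ xs) zero    = x
nth (x ∷ xs) (suc i) = nth xs i

insertDesc : ℕ → List ℕ → List ℕ
insertDesc x []       = x ∷ []
insertDesc x (y ∷ ys) = if y ≤ᵇ x then x ∷ y ∷ ys else y ∷ insertDesc x ys

sortDesc : List ℕ → List ℕ
sortDesc = foldr insertDesc []

insertAsc : ℕ → List ℕ → List ℕ
insertAsc x []       = x ∷ []
insertAsc x (y ∷ ys) = if x ≤ᵇ y then x ∷ y ∷ ys else y ∷ insertAsc x ys

sortAsc : List ℕ → List ℕ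
sortAsc = foldr insertAsc []

-- n(μ) = Σ_i (i-1) μ_i   (rows 1-based; here index i from 0)
nStat : List ℕ → ℕ
nStat μ = sumℕ (mapL (λ i → i ℕ.* nth μ i) (range (length μ)))

mult : ℕ → List ℕ → ℕ
mult i μ = countL (λ x → (x ≤ᵇ i) ∧ (i ≤ᵇ x)) μ

invStat : List ℕ → ℕ
invStat []       = 0
invStat (x ∷ xs) = countL (λ y → y <ᵇ x) xs ℕ.+ invStat xs

sortLG : List ℕ → List ℕ → List ℕ
sortLG la ga = sortDesc (la ++ ga)

-- Arm/leg statistics for ν = (λ_-, γ).  Rows are 0-based (r, i),
-- columns j are 1-based, as in the paper.

armLeft : List ℕ → ℕ → ℕ → ℕ
armLeft ν i j =
  countL (λ r → (j ≤ᵇ nth ν r) ∧ (nth ν r ≤ᵇ nth ν i)) (range i)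

rowsAfter : List ℕ → ℕ → List ℕ
rowsAfter ν i = rangeFrom (suc i) (length ν ∸ suc i)

armA : List ℕ → ℕ → ℕ → ℕ
armA ν i j = armLeft ν i j ℕ.+
  countL (λ r → ((j ∸ 1) ≤ᵇ nth ν r) ∧ (nth ν r <ᵇ nth ν i)) (rowsAfter ν i)

armTilde : List ℕ → ℕ → ℕ → ℕ
armTilde ν i j = armLeft ν i j ℕ.+
  countL (λ r → (j ≤ᵇ nth ν r) ∧ (nth ν r <ᵇ nth ν i)) (rowsAfter ν i)

legL : List ℕ → ℕ → ℕ → ℕ
legL ν i j = nth ν i ∸ j

_^ℚ_ : ℚ → ℕ → ℚ
p ^ℚ zero  = 1ℚ
p ^ℚ suc n = p * (p ^ℚ n)

-- total division: p / q, and 0 if q = 0 (only used where q ≠ 0)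
_÷₀_ : ℚ → ℚ → ℚ
p ÷₀ q with q ≟ 0ℚ
... | yes _  = 0ℚ
... | no q≢0 = _÷_ p q {{≢-nonZero q≢0}}

rowBoxes : List ℕ → ℕ → List ℕ
rowBoxes ν i = rangeFrom 1 (nth ν i)

jPoly : List ℕ → List ℕ → ℚ → ℚ → ℚ
jPoly la ga q t =
  prodℚ (concatMapL
    (λ i → mapL (λ j → 1ℚ - (q ^ℚ legL ν i j) * (t ^ℚ suc (armTilde ν i j)))
                (rowBoxes ν i))
    (range (length la)))
  * prodℚ (concatMapL
    (λ i → mapL (λ j → 1ℚ - (q ^ℚ suc (legL ν i j)) * (t ^ℚ suc (armA ν i j)))
                (rowBoxes ν i))
    (rangeFrom (length la) (length ga)))
  where
    ν : List ℕ
    ν = sortAsc la ++ ga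

-- ∏_{i≥1} ∏_{j=1}^{m_i(λ)} (1 - t^j)   (parts of λ are ≤ |λ|)
multFactor : List ℕ → ℚ → ℚ
multFactor la t =
  prodℚ (concatMapL (λ i → mapL (λ j → 1ℚ - t ^ℚ j) (rangeFrom 1 (mult i la)))
                    (rangeFrom 1 (sumℕ la)))

gFun : List ℕ → List ℕ → ℚ → ℚ → ℚ
gFun la ga q t =
  (jPoly la ga q (1ℚ ÷₀ t)
    * t ^ℚ (invStat ga ℕ.+ nStat (sortLG la ga) ℕ.+ sumℕ la ℕ.+ sumℕ ga))
  ÷₀ multFactor la t

-- Write the increasing rearrangement of λ as low ++ (c+1)^m with all parts of low at most c.
-- Then ν = (λ₋, γ₁ … γ_{k-1}, c) and ν′ = ((c+1, λ)₋, γ₁ … γ_{k-1}) both consist of low, a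
-- block of long rows of length c + 1 (m of them in ν, m + 1 in ν′) and γ₁ … γ_{k-1}, and j is
-- a product over rows whose factors depend only on the parts above and below each row.
-- The rows of low and of γ₁ … γ_{k-1} give the same factors in ν and ν′. Inside the block,
-- the final part c of ν makes the first c boxes of its r-th long row look like those of the
-- (r+1)-th long row of ν′, the final row c of ν looks like the first c boxes of the first
-- long row of ν′, and the last boxes of the first m long rows agree. Only the last box of
-- the (m+1)-th long row of ν′ is left over, so j_ν′(q, t) = j_ν(q, t) (1 - t^(m+1)). Since g
-- evaluates j at t⁻¹, while the exponent of t grows by m + 1 and the multiplicity product
-- gains the factor 1 - t^(m+1), the two values of g differ by the factor
-- (1 - t^-(m+1)) t^(m+1) / (1 - t^(m+1)) = -1.

module Submission where

open import Defs
open import Data.Nat using (ℕ; suc; _≤_)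
open import Data.List using (List; _∷_; []; _++_)
open import Data.Product using (_×_; ∃₂)
open import Data.Rational using (ℚ; 0ℚ; 1ℚ; -_)
open import Relation.Binary.PropositionalEquality using (_≡_; _≢_)

import Algebra.Properties.CommutativeSemigroup as CommutativeSemigroupProperties
open import Data.Bool using (Bool; true; false; T; if_then_else_; _∧_)
open import Data.Bool.Properties using (∧-zeroʳ; ∧-identityʳ)
open import Data.Empty using (⊥-elim)
open import Data.List using (length; replicate)
open import Data.List.Properties using (++-assoc; ++-identityʳ; length-++)
open import Data.List.Relation.Unary.All as All using (All; []; _∷_)
open import Data.List.Relation.Unary.All.Properties using (replicate⁺)
open import Data.List.Relation.Unary.AllPairs using (AllPairs; []; _∷_)
open import Data.List.Relation.Unary.Linked using (Linked)
open import Data.List.Relation.Unary.Linked.Properties using (Linked⇒All)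
open import Data.Maybe using (just; nothing)
open import Data.Nat as ℕ using (zero; _+_; _<_; _∸_; _⊓_; _≤ᵇ_; _<ᵇ_; z≤n; s≤s; s≤s⁻¹)
open import Data.Nat.Properties
  using ( ≤-refl; ≤-trans; <⇒≤; ≤-<-trans; <⇒≱; ≤⇒≯; <⇒≢; ≰⇒>; ≤∧≢⇒<; m≤n⇒m<n∨m≡n
        ; m≤m+n; m≤n+m; m≤n⇒m≤1+n; n<1+n; ≤⇒≤ᵇ; ≤ᵇ⇒≤; <⇒<ᵇ; <ᵇ⇒<
        ; +-assoc; +-comm; +-suc; +-identityʳ; +-∸-assoc; n∸n≡0
        ; ⊓-comm; m≥n⇒m⊓n≡n; m≤n⇒m⊓n≡m; +-commutativeSemigroup )
import Data.Nat.Tactic.RingSolver as ℕ-Solver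
open import Data.Product using (_,_; ∃; proj₁; proj₂)
open import Data.Rational using (½; _*_; _-_; _÷_; 1/_; ≢-nonZero) renaming (_≤_ to _≤ℚ_)
import Data.Rational.Properties as ℚ
open import Data.Sum using (inj₁; inj₂)
open import Data.Unit using (tt)
open import Level using (0ℓ)
open import Relation.Binary.PropositionalEquality
  using (refl; sym; trans; cong; cong₂; subst; subst₂; ≢-sym; module ≡-Reasoning)
open import Relation.Nullary using (¬_; yes; no)
open import Relation.Nullary.Decidable using (toWitness)
open import Tactic.RingSolver using (solve-∀)
import Tactic.RingSolver.Core.AlmostCommutativeRing as ACR

open CommutativeSemigroupProperties +-commutativeSemigroup
  using ()
  renaming (interchange to +-interchange; x∙yz≈y∙xz to +-left-comm; x∙yz≈yx∙z to +-rotate; x∙yz≈xz∙y to +-swapʳ)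

T⇒≡true : ∀ {b} → T b → b ≡ true
T⇒≡true {true} _ = refl

¬T⇒≡false : ∀ {b} → ¬ T b → b ≡ false
¬T⇒≡false {false} _  = refl
¬T⇒≡false {true}  ¬t = ⊥-elim (¬t tt)

≤ᵇ-true : ∀ {m n} → m ≤ n → (m ≤ᵇ n) ≡ true
≤ᵇ-true m≤n = T⇒≡true (≤⇒≤ᵇ m≤n)

≤ᵇ-false : ∀ {m n} → n < m → (m ≤ᵇ n) ≡ false
≤ᵇ-false {m} {n} n<m = ¬T⇒≡false (λ m≤ᵇn → <⇒≱ n<m (≤ᵇ⇒≤ m n m≤ᵇn))

≤ᵇ≡true⇒≤ : ∀ {m n} → (m ≤ᵇ n) ≡ true → m ≤ n
≤ᵇ≡true⇒≤ {m} {n} m≤ᵇn = ≤ᵇ⇒≤ m n (subst T (sym m≤ᵇn) tt)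

≤ᵇ≡false⇒> : ∀ {m n} → (m ≤ᵇ n) ≡ false → n < m
≤ᵇ≡false⇒> m≰ᵇn = ≰⇒> (λ m≤n → subst T m≰ᵇn (≤⇒≤ᵇ m≤n))

<ᵇ-true : ∀ {m n} → m < n → (m <ᵇ n) ≡ true
<ᵇ-true m<n = T⇒≡true (<⇒<ᵇ m<n)

<ᵇ-false : ∀ {m n} → n ≤ m → (m <ᵇ n) ≡ false
<ᵇ-false {m} {n} n≤m = ¬T⇒≡false (λ m<ᵇn → ≤⇒≯ n≤m (<ᵇ⇒< m n m<ᵇn))

≤ᵇ≡<ᵇsuc : ∀ m n → (m ≤ᵇ n) ≡ (m <ᵇ suc n)
≤ᵇ≡<ᵇsuc zero    n = refl
≤ᵇ≡<ᵇsuc (suc m) n = refl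

pred≤ᵇ≡≤ᵇsuc : ∀ m n → (m ∸ 1 ≤ᵇ n) ≡ (m ≤ᵇ suc n)
pred≤ᵇ≡≤ᵇsuc zero    n = refl
pred≤ᵇ≡≤ᵇsuc (suc m) n = ≤ᵇ≡<ᵇsuc m n

indicator : Bool → ℕ
indicator b = if b then 1 else 0

module _ {A : Set} (p : A → Bool) where

  countL-∷ : ∀ x xs → countL p (x ∷ xs) ≡ indicator (p x) + countL p xs
  countL-∷ x xs with p x
  ... | true  = refl
  ... | false = refl

  countL-++ : ∀ xs ys → countL p (xs ++ ys) ≡ countL p xs + countL p ys
  countL-++ []       ys = refl
  countL-++ (x ∷ xs) ys with p x
  ... | true  = cong suc (countL-++ xs ys)
  ... | false = countL-++ xs ys

  countL-none : ∀ {xs} → All (λ x → p x ≡ false) xs → countL p xs ≡ 0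
  countL-none []                = refl
  countL-none {x ∷ xs} (px ∷ pxs) rewrite px = countL-none pxs

  countL-replicate : ∀ n {v} → p v ≡ true → countL p (replicate n v) ≡ n
  countL-replicate zero    pv = refl
  countL-replicate (suc n) pv rewrite pv = cong suc (countL-replicate n pv)

countL-cong : ∀ {A : Set} {p p′ : A → Bool} {xs} → All (λ x → p x ≡ p′ x) xs → countL p xs ≡ countL p′ xs
countL-cong                     []       = refl
countL-cong {p = p} {p′} {x ∷ xs} (e ∷ es) rewrite e with p′ x
... | true  = cong suc (countL-cong es)
... | false = countL-cong es

countL-mapL : ∀ {A B : Set} (p : B → Bool) (f : A → B) xs → countL p (mapL f xs) ≡ countL (λ x → p (f x)) xs
countL-mapL p f []       = refl
countL-mapL p f (x ∷ xs) with p (f x)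
... | true  = cong suc (countL-mapL p f xs)
... | false = countL-mapL p f xs

countL-insert : ∀ {A : Set} (p : A → Bool) xs y ys → countL p (xs ++ y ∷ ys) ≡ indicator (p y) + countL p (xs ++ ys)
countL-insert p []       y ys = countL-∷ p y ys
countL-insert p (x ∷ xs) y ys = begin
  countL p (x ∷ xs ++ y ∷ ys)
    ≡⟨ countL-∷ p x (xs ++ y ∷ ys) ⟩
  indicator (p x) + countL p (xs ++ y ∷ ys)
    ≡⟨ cong (indicator (p x) +_) (countL-insert p xs y ys) ⟩
  indicator (p x) + (indicator (p y) + countL p (xs ++ ys))
    ≡⟨ +-left-comm (indicator (p x)) (indicator (p y)) (countL p (xs ++ ys)) ⟩
  indicator (p y) + (indicator (p x) + countL p (xs ++ ys))
    ≡⟨ cong (indicator (p y) +_) (sym (countL-∷ p x (xs ++ ys))) ⟩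
  indicator (p y) + countL p (x ∷ xs ++ ys) ∎
  where open ≡-Reasoning

mapL-cong : ∀ {A B : Set} {f g : A → B} {xs} → All (λ x → f x ≡ g x) xs → mapL f xs ≡ mapL g xs
mapL-cong []       = refl
mapL-cong (e ∷ es) = cong₂ _∷_ e (mapL-cong es)

mapL-++ : ∀ {A B : Set} (f : A → B) xs ys → mapL f (xs ++ ys) ≡ mapL f xs ++ mapL f ys
mapL-++ f []       ys = refl
mapL-++ f (x ∷ xs) ys = cong (f x ∷_) (mapL-++ f xs ys)

sumℕ-++ : ∀ xs ys → sumℕ (xs ++ ys) ≡ sumℕ xs + sumℕ ys
sumℕ-++ []       ys = refl
sumℕ-++ (x ∷ xs) ys = trans (cong (x +_) (sumℕ-++ xs ys)) (sym (+-assoc x _ _))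

sumℕ-mapL-+ : ∀ (f g : ℕ → ℕ) xs → sumℕ (mapL (λ i → f i + g i) xs) ≡ sumℕ (mapL f xs) + sumℕ (mapL g xs)
sumℕ-mapL-+ f g []       = refl
sumℕ-mapL-+ f g (x ∷ xs) = trans (cong (f x + g x +_) (sumℕ-mapL-+ f g xs)) (+-interchange (f x) (g x) _ _)

length-snoc : ∀ {X : Set} (A : List X) x → length (A ++ x ∷ []) ≡ suc (length A)
length-snoc A x = trans (length-++ A) (+-comm (length A) 1)

rangeFrom-+ : ∀ a m n → rangeFrom a (m + n) ≡ rangeFrom a m ++ rangeFrom (a + m) n
rangeFrom-+ a zero    n = cong (λ b → rangeFrom b n) (sym (+-identityʳ a))
rangeFrom-+ a (suc m) n = cong (a ∷_)
  (trans (rangeFrom-+ (suc a) m n) (cong (λ b → rangeFrom (suc a) m ++ rangeFrom b n) (sym (+-suc a m))))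

rangeFrom-bounds : ∀ a n → All (λ j → a ≤ j × j < a + n) (rangeFrom a n)
rangeFrom-bounds a zero    = []
rangeFrom-bounds a (suc n) =
  (≤-refl , subst (a <_) (sym (+-suc a n)) (s≤s (m≤m+n a n)))
  ∷ All.map (λ {j} (a<j , j<) → <⇒≤ a<j , subst (j <_) (sym (+-suc a n)) j<) (rangeFrom-bounds (suc a) n)

mapL-rangeFrom-suc : ∀ {B : Set} (f : ℕ → B) a n → mapL f (rangeFrom (suc a) n) ≡ mapL (λ i → f (suc i)) (rangeFrom a n)
mapL-rangeFrom-suc f a zero    = refl
mapL-rangeFrom-suc f a (suc n) = cong (f (suc a) ∷_) (mapL-rangeFrom-suc f (suc a) n)

mapL-nth-range : ∀ B C → mapL (nth (B ++ C)) (range (length B)) ≡ B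
mapL-nth-range []      C = refl
mapL-nth-range (b ∷ B) C = cong (b ∷_) (trans (mapL-rangeFrom-suc (nth (b ∷ B ++ C)) 0 (length B)) (mapL-nth-range B C))

mapL-nth-all : ∀ ν → mapL (nth ν) (range (length ν)) ≡ ν
mapL-nth-all ν = subst (λ ν′ → mapL (nth ν′) (range (length ν)) ≡ ν) (++-identityʳ ν) (mapL-nth-range ν [])

mapL-nth-rowsAfter : ∀ A x B → mapL (nth (A ++ x ∷ B)) (rowsAfter (A ++ x ∷ B) (length A)) ≡ B
mapL-nth-rowsAfter []      x B = trans (mapL-rangeFrom-suc (nth (x ∷ B)) 0 (length B)) (mapL-nth-all B)
mapL-nth-rowsAfter (a ∷ A) x B =
  trans (mapL-rangeFrom-suc (nth (a ∷ A ++ x ∷ B)) (suc (length A)) _) (mapL-nth-rowsAfter A x B)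

nth-length : ∀ A x B → nth (A ++ x ∷ B) (length A) ≡ x
nth-length []      x B = refl
nth-length (a ∷ A) x B = nth-length A x B

ℚ-ring : ACR.AlmostCommutativeRing 0ℓ 0ℓ
ℚ-ring = ACR.fromCommutativeRing ℚ.+-*-commutativeRing zero?
  where
  zero? : (p : ℚ) → _
  zero? p with 0ℚ ℚ.≟ p
  ... | yes 0≡p = just 0≡p
  ... | no _    = nothing

÷₀-nonZero : ∀ p {q} (q≢0 : q ≢ 0ℚ) → p ÷₀ q ≡ _÷_ p q {{≢-nonZero q≢0}}
÷₀-nonZero p {q} q≢0 with q ℚ.≟ 0ℚ
... | yes q≡0 = ⊥-elim (q≢0 q≡0)
... | no  _   = refl

÷₀-*-cancel : ∀ p {q} → q ≢ 0ℚ → (p ÷₀ q) * q ≡ p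
÷₀-*-cancel p {q} q≢0 = begin
  (p ÷₀ q) * q                              ≡⟨ cong (_* q) (÷₀-nonZero p q≢0) ⟩
  p * 1/ q * q                              ≡⟨ ℚ.*-assoc p _ q ⟩
  p * (1/ q * q)                            ≡⟨ cong (p *_) (ℚ.*-inverseˡ q) ⟩
  p * 1ℚ                                    ≡⟨ ℚ.*-identityʳ p ⟩
  p                                         ∎
  where
  open ≡-Reasoning
  instance _ = ≢-nonZero q≢0

÷₀-unique : ∀ {p q r} → q ≢ 0ℚ → p ≡ r * q → p ÷₀ q ≡ r
÷₀-unique {p} {q} {r} q≢0 p≡rq = begin
  p ÷₀ q                                    ≡⟨ ÷₀-nonZero p q≢0 ⟩
  p * 1/ q                                  ≡⟨ cong (_* 1/ q) p≡rq ⟩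
  r * q * 1/ q                              ≡⟨ ℚ.*-assoc r q _ ⟩
  r * (q * 1/ q)                            ≡⟨ cong (r *_) (ℚ.*-inverseʳ q) ⟩
  r * 1ℚ                                    ≡⟨ ℚ.*-identityʳ r ⟩
  r                                         ∎
  where
  open ≡-Reasoning
  instance _ = ≢-nonZero q≢0

÷₀-≢0⇒denominator≢0 : ∀ p {q} → p ÷₀ q ≢ 0ℚ → q ≢ 0ℚ
÷₀-≢0⇒denominator≢0 p p÷q≢0 refl = p÷q≢0 refl

÷₀-≢0 : ∀ {p q} → p ≢ 0ℚ → q ≢ 0ℚ → p ÷₀ q ≢ 0ℚ
÷₀-≢0 {p} {q} p≢0 q≢0 p÷q≡0 = p≢0 (begin
  p             ≡⟨ sym (÷₀-*-cancel p q≢0) ⟩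
  (p ÷₀ q) * q  ≡⟨ cong (_* q) p÷q≡0 ⟩
  0ℚ * q        ≡⟨ ℚ.*-zeroˡ q ⟩
  0ℚ            ∎)
  where open ≡-Reasoning

*-≢0 : ∀ {p q} → p ≢ 0ℚ → q ≢ 0ℚ → p * q ≢ 0ℚ
*-≢0 {p} {q} p≢0 q≢0 pq≡0 = q≢0 (begin
  q                ≡⟨ sym (trans (cong (_* q) (ℚ.*-inverseˡ p)) (ℚ.*-identityˡ q)) ⟩
  1/ p * p * q     ≡⟨ ℚ.*-assoc (1/ p) p q ⟩
  1/ p * (p * q)   ≡⟨ cong (1/ p *_) pq≡0 ⟩
  1/ p * 0ℚ        ≡⟨ ℚ.*-zeroʳ (1/ p) ⟩
  0ℚ               ∎)
  where
  open ≡-Reasoning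
  instance _ = ≢-nonZero p≢0

1-x≢0 : ∀ {x} → x ≢ 1ℚ → 1ℚ - x ≢ 0ℚ
1-x≢0 {x} x≢1 1-x≡0 = x≢1 (begin
  x                  ≡⟨ cancel x ⟩
  1ℚ - (1ℚ - x)      ≡⟨ cong (λ z → 1ℚ - z) 1-x≡0 ⟩
  1ℚ - 0ℚ            ≡⟨⟩
  1ℚ                 ∎)
  where
  open ≡-Reasoning
  cancel : ∀ x → x ≡ 1ℚ - (1ℚ - x)
  cancel = solve-∀ ℚ-ring

complement-reciprocal : ∀ x y → x * y ≡ 1ℚ → (1ℚ - x) * y ≡ - (1ℚ - y)
complement-reciprocal x y xy≡1 = begin
  (1ℚ - x) * y    ≡⟨ expand x y ⟩
  y - x * y       ≡⟨ cong (λ z → y - z) xy≡1 ⟩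
  y - 1ℚ          ≡⟨ swap-sign y ⟩
  - (1ℚ - y)      ∎
  where
  open ≡-Reasoning
  expand : ∀ x y → (1ℚ - x) * y ≡ y - x * y
  expand = solve-∀ ℚ-ring
  swap-sign : ∀ y → y - 1ℚ ≡ - (1ℚ - y)
  swap-sign = solve-∀ ℚ-ring

neg-ratio : ∀ {N₁ M₁ N₂ M₂ δ} → N₂ ≡ - (N₁ * δ) → M₂ ≡ M₁ * δ → N₂ ÷₀ M₂ ≢ 0ℚ →
  - ((N₁ ÷₀ M₁) ÷₀ (N₂ ÷₀ M₂)) ≡ 1ℚ
neg-ratio {N₁} {M₁} {N₂} {M₂} {δ} N₂≡ M₂≡ g₂≢0 =
  cong -_ (÷₀-unique {r = - 1ℚ} g₂≢0 (trans (double-neg g₁) (cong (- 1ℚ *_) (sym g₂≡-g₁))))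
  where
  open ≡-Reasoning
  g₁ = N₁ ÷₀ M₁
  M₂≢0 = ÷₀-≢0⇒denominator≢0 N₂ g₂≢0
  M₁≢0 : M₁ ≢ 0ℚ
  M₁≢0 M₁≡0 = M₂≢0 (trans M₂≡ (trans (cong (_* δ) M₁≡0) (ℚ.*-zeroˡ δ)))
  move-neg : ∀ g m d → - (g * m * d) ≡ - g * (m * d)
  move-neg = solve-∀ ℚ-ring
  double-neg : ∀ g → g ≡ - 1ℚ * - g
  double-neg = solve-∀ ℚ-ring
  g₂≡-g₁ : N₂ ÷₀ M₂ ≡ - g₁
  g₂≡-g₁ = ÷₀-unique M₂≢0 (begin
    N₂                ≡⟨ N₂≡ ⟩
    - (N₁ * δ)        ≡⟨ cong (λ n → - (n * δ)) (sym (÷₀-*-cancel N₁ M₁≢0)) ⟩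
    - (g₁ * M₁ * δ)   ≡⟨ move-neg g₁ M₁ δ ⟩
    - g₁ * (M₁ * δ)   ≡⟨ cong (- g₁ *_) (sym M₂≡) ⟩
    - g₁ * M₂         ∎)

^ℚ-+ : ∀ t m n → t ^ℚ (m + n) ≡ t ^ℚ m * t ^ℚ n
^ℚ-+ t zero    n = sym (ℚ.*-identityˡ _)
^ℚ-+ t (suc m) n = trans (cong (t *_) (^ℚ-+ t m n)) (sym (ℚ.*-assoc t _ _))

^ℚ-*-distrib : ∀ p q n → (p * q) ^ℚ n ≡ p ^ℚ n * q ^ℚ n
^ℚ-*-distrib p q zero    = refl
^ℚ-*-distrib p q (suc n) = trans (cong (p * q *_) (^ℚ-*-distrib p q n)) (interchange p q _ _)
  where
  interchange : ∀ a b c d → a * b * (c * d) ≡ a * c * (b * d)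
  interchange = solve-∀ ℚ-ring

1^ℚ : ∀ n → 1ℚ ^ℚ n ≡ 1ℚ
1^ℚ zero    = refl
1^ℚ (suc n) = trans (ℚ.*-identityˡ _) (1^ℚ n)

^ℚ-inverse : ∀ {t} n → t ≢ 0ℚ → (1ℚ ÷₀ t) ^ℚ n * t ^ℚ n ≡ 1ℚ
^ℚ-inverse {t} n t≢0 = trans (sym (^ℚ-*-distrib (1ℚ ÷₀ t) t n)) (trans (cong (_^ℚ n) (÷₀-*-cancel 1ℚ t≢0)) (1^ℚ n))

^ℚ-≢0 : ∀ {t} n → t ≢ 0ℚ → t ^ℚ n ≢ 0ℚ
^ℚ-≢0 zero    t≢0 = ℚ.1≢0
^ℚ-≢0 (suc n) t≢0 = *-≢0 t≢0 (^ℚ-≢0 n t≢0)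

prodℚ-++ : ∀ xs ys → prodℚ (xs ++ ys) ≡ prodℚ xs * prodℚ ys
prodℚ-++ []       ys = sym (ℚ.*-identityˡ _)
prodℚ-++ (x ∷ xs) ys = trans (cong (x *_) (prodℚ-++ xs ys)) (sym (ℚ.*-assoc x _ _))

prodℚ-concatMapL : ∀ {A : Set} (f : A → List ℚ) xs →
  prodℚ (concatMapL f xs) ≡ prodℚ (mapL (λ x → prodℚ (f x)) xs)
prodℚ-concatMapL f []       = refl
prodℚ-concatMapL f (x ∷ xs) = trans (prodℚ-++ (f x) _) (cong (prodℚ (f x) *_) (prodℚ-concatMapL f xs))

prodℚ-mapL-cong-range : ∀ {f g : ℕ → ℚ} n → (∀ j → j ≤ n → f j ≡ g j) →
  prodℚ (mapL f (rangeFrom 1 n)) ≡ prodℚ (mapL g (rangeFrom 1 n))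
prodℚ-mapL-cong-range n e = cong prodℚ (mapL-cong (All.map (λ {j} (_ , j≤n) → e j (s≤s⁻¹ j≤n)) (rangeFrom-bounds 1 n)))

prodℚ-mapL-rangeFrom-suc : ∀ (f : ℕ → ℚ) n →
  prodℚ (mapL f (rangeFrom 1 (suc n))) ≡ prodℚ (mapL f (rangeFrom 1 n)) * f (suc n)
prodℚ-mapL-rangeFrom-suc f n = begin
  prodℚ (mapL f (rangeFrom 1 (suc n)))
    ≡⟨ cong (λ r → prodℚ (mapL f r)) (trans (cong (rangeFrom 1) (+-comm 1 n)) (rangeFrom-+ 1 n 1)) ⟩
  prodℚ (mapL f (rangeFrom 1 n ++ suc n ∷ []))
    ≡⟨ trans (cong prodℚ (mapL-++ f (rangeFrom 1 n) _)) (prodℚ-++ (mapL f (rangeFrom 1 n)) _) ⟩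
  prodℚ (mapL f (rangeFrom 1 n)) * (f (suc n) * 1ℚ)
    ≡⟨ cong (prodℚ (mapL f (rangeFrom 1 n)) *_) (ℚ.*-identityʳ (f (suc n))) ⟩
  prodℚ (mapL f (rangeFrom 1 n)) * f (suc n) ∎
  where open ≡-Reasoning

prodℚ-mapL-ones : ∀ {A : Set} {f : A → ℚ} {xs} → All (λ x → f x ≡ 1ℚ) xs → prodℚ (mapL f xs) ≡ 1ℚ
prodℚ-mapL-ones []       = refl
prodℚ-mapL-ones (e ∷ es) = trans (cong₂ _*_ e (prodℚ-mapL-ones es)) (ℚ.*-identityˡ 1ℚ)

prodℚ-mapL-update : ∀ {f g : ℕ → ℚ} {v δ} a n → a ≤ v → v < a + n →
  (∀ i → i ≢ v → f i ≡ g i) → f v ≡ g v * δ →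
  prodℚ (mapL f (rangeFrom a n)) ≡ prodℚ (mapL g (rangeFrom a n)) * δ
prodℚ-mapL-update a zero a≤v v<a+0 _ _ = ⊥-elim (<⇒≱ v<a+0 (subst (_≤ _) (sym (+-identityʳ a)) a≤v))
prodℚ-mapL-update {f} {g} {v} {δ} a (suc n) a≤v v<a+n off at with a ℕ.≟ v
... | yes refl = begin
  f a * prodℚ (mapL f (rangeFrom (suc a) n))    ≡⟨ cong₂ _*_ at (cong prodℚ (mapL-cong above)) ⟩
  g a * δ * prodℚ (mapL g (rangeFrom (suc a) n)) ≡⟨ swap (g a) δ _ ⟩
  g a * prodℚ (mapL g (rangeFrom (suc a) n)) * δ ∎
  where
  open ≡-Reasoning
  above : All (λ i → f i ≡ g i) (rangeFrom (suc a) n)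
  above = All.map (λ (a<i , _) → off _ (≢-sym (<⇒≢ a<i))) (rangeFrom-bounds (suc a) n)
  swap : ∀ x d r → x * d * r ≡ x * r * d
  swap = solve-∀ ℚ-ring
... | no  a≢v = trans
  (cong₂ _*_ (off a a≢v) (prodℚ-mapL-update (suc a) n (≤∧≢⇒< a≤v a≢v) (subst (v <_) (+-suc a n) v<a+n) off at))
  (sym (ℚ.*-assoc (g a) _ δ))

prodℚ-mapL-≢0 : ∀ {A : Set} {f : A → ℚ} {xs} → All (λ x → f x ≢ 0ℚ) xs → prodℚ (mapL f xs) ≢ 0ℚ
prodℚ-mapL-≢0 []       = ℚ.1≢0
prodℚ-mapL-≢0 (p ∷ ps) = *-≢0 p (prodℚ-mapL-≢0 ps)

length-insertAsc : ∀ x ys → length (insertAsc x ys) ≡ suc (length ys)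
length-insertAsc x []       = refl
length-insertAsc x (y ∷ ys) with x ≤ᵇ y
... | true  = refl
... | false = cong suc (length-insertAsc x ys)

length-sortAsc : ∀ xs → length (sortAsc xs) ≡ length xs
length-sortAsc []       = refl
length-sortAsc (x ∷ xs) = trans (length-insertAsc x (sortAsc xs)) (cong suc (length-sortAsc xs))

insertAsc-top : ∀ {v} low m → All (_< v) low → insertAsc v (low ++ replicate m v) ≡ low ++ v ∷ replicate m v
insertAsc-top         []        zero    _              = refl
insertAsc-top {v}     []        (suc m) _              rewrite ≤ᵇ-true (≤-refl {v}) = refl
insertAsc-top         (y ∷ low) m       (y<v ∷ low<v) rewrite ≤ᵇ-false y<v = cong (y ∷_) (insertAsc-top low m low<v)

insertAsc-below : ∀ {v x} low m → x < v → All (_< v) low →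
  ∃ λ low′ → All (_< v) low′ × insertAsc x (low ++ replicate m v) ≡ low′ ++ replicate m v
insertAsc-below         []        zero    x<v _ = _ , x<v ∷ [] , refl
insertAsc-below         []        (suc m) x<v _ rewrite ≤ᵇ-true (<⇒≤ x<v) = _ , x<v ∷ [] , refl
insertAsc-below {x = x} (y ∷ low) m       x<v (y<v ∷ low<v) with x ≤ᵇ y
... | true  = _ , x<v ∷ y<v ∷ low<v , refl
... | false with insertAsc-below low m x<v low<v
...   | low′ , low′<v , eq = y ∷ low′ , y<v ∷ low′<v , cong (y ∷_) eq

mult-∷-≢ : ∀ {v x} la → x ≢ v → mult v (x ∷ la) ≡ mult v la
mult-∷-≢ {v} {x} la x≢v = trans (countL-∷ _ x la) (cong (λ b → indicator b + mult v la) unequal)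
  where
  unequal : ((x ≤ᵇ v) ∧ (v ≤ᵇ x)) ≡ false
  unequal with x ℕ.≤? v
  ... | yes x≤v = trans (cong ((x ≤ᵇ v) ∧_) (≤ᵇ-false (≤∧≢⇒< x≤v x≢v))) (∧-zeroʳ _)
  ... | no  x≰v = cong (_∧ (v ≤ᵇ x)) (≤ᵇ-false (≰⇒> x≰v))

mult-∷-self : ∀ v la → mult v (v ∷ la) ≡ suc (mult v la)
mult-∷-self v la rewrite ≤ᵇ-true (≤-refl {v}) = refl

sortAsc-split : ∀ {v} la → All (_≤ v) la →
  ∃ λ low → All (_< v) low × sortAsc la ≡ low ++ replicate (mult v la) v
sortAsc-split [] [] = [] , [] , refl
sortAsc-split {v} (x ∷ la) (x≤v ∷ la≤v) with sortAsc-split la la≤v | m≤n⇒m<n∨m≡n x≤v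
... | low , low<v , eq | inj₂ refl = low , low<v , (begin
  insertAsc v (sortAsc la)                      ≡⟨ cong (insertAsc v) eq ⟩
  insertAsc v (low ++ replicate (mult v la) v)  ≡⟨ insertAsc-top low (mult v la) low<v ⟩
  low ++ replicate (suc (mult v la)) v          ≡⟨ cong (λ m → low ++ replicate m v) (sym (mult-∷-self v la)) ⟩
  low ++ replicate (mult v (v ∷ la)) v          ∎)
  where open ≡-Reasoning
... | low , low<v , eq | inj₁ x<v with insertAsc-below low (mult v la) x<v low<v
...   | low′ , low′<v , eq′ = low′ , low′<v , (begin
  insertAsc x (sortAsc la)                      ≡⟨ cong (insertAsc x) eq ⟩
  insertAsc x (low ++ replicate (mult v la) v)  ≡⟨ eq′ ⟩
  low′ ++ replicate (mult v la) v               ≡⟨ cong (λ m → low′ ++ replicate m v) (sym (mult-∷-≢ la (<⇒≢ x<v))) ⟩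
  low′ ++ replicate (mult v (x ∷ la)) v         ∎)
  where open ≡-Reasoning

parts≤head : ∀ {v} la → Linked (λ a b → b ≤ a) la → head0 la ≤ v → All (_≤ v) la
parts≤head []      _          _   = []
parts≤head (x ∷ _) decreasing x≤v = Linked⇒All (λ b≤a c≤b → ≤-trans c≤b b≤a) x≤v decreasing

-- Arms and the row-by-row form of j

leftArm : ℕ → ℕ → List ℕ → ℕ
leftArm j x = countL (λ y → (j ≤ᵇ y) ∧ (y ≤ᵇ x))

rightArm : ℕ → ℕ → List ℕ → ℕ
rightArm j x = countL (λ y → (j ≤ᵇ y) ∧ (y <ᵇ x))

-- The paper's ã_ν and a_ν of the box in column j of the row x of ν = A ++ x ∷ B.
tildeArm : List ℕ → ℕ → List ℕ → ℕ → ℕ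
tildeArm A x B j = leftArm j x A + rightArm j x B

plainArm : List ℕ → ℕ → List ℕ → ℕ → ℕ
plainArm A x B j = leftArm j x A + rightArm (j ∸ 1) x B

leftArm-++ : ∀ j x ys zs → leftArm j x (ys ++ zs) ≡ leftArm j x ys + leftArm j x zs
leftArm-++ j x = countL-++ _

rightArm-++ : ∀ j x ys zs → rightArm j x (ys ++ zs) ≡ rightArm j x ys + rightArm j x zs
rightArm-++ j x = countL-++ _

rightArm-snoc : ∀ j x ys y → rightArm j x (ys ++ y ∷ []) ≡ rightArm j x ys + indicator ((j ≤ᵇ y) ∧ (y <ᵇ x))
rightArm-snoc j x ys y = rightArm-++ j x ys (y ∷ [])

rightArm-≥ : ∀ j x {ys} → All (x ≤_) ys → rightArm j x ys ≡ 0
rightArm-≥ j x x≤ys =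
  countL-none _ (All.map (λ {y} x≤y → trans (cong ((j ≤ᵇ y) ∧_) (<ᵇ-false x≤y)) (∧-zeroʳ _)) x≤ys)

rightArm-replicate-++ : ∀ j x n {v} ys → x ≤ v → rightArm j x (replicate n v ++ ys) ≡ rightArm j x ys
rightArm-replicate-++ j x n ys x≤v =
  trans (rightArm-++ j x (replicate n _) ys) (cong (_+ rightArm j x ys) (rightArm-≥ j x (replicate⁺ n x≤v)))

rightArm-self : ∀ x ys → rightArm x x ys ≡ 0
rightArm-self x ys = countL-none _ (All.universal empty ys)
  where
  empty : ∀ y → ((x ≤ᵇ y) ∧ (y <ᵇ x)) ≡ false
  empty y with x ≤ᵇ y in x≤ᵇy
  ... | false = refl
  ... | true  = <ᵇ-false {y} {x} (≤ᵇ≡true⇒≤ {x} {y} x≤ᵇy)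

armLeft-zipper : ∀ A x B j → armLeft (A ++ x ∷ B) (length A) j ≡ leftArm j x A
armLeft-zipper A x B j = begin
  armLeft ν (length A) j
    ≡⟨ sym (countL-mapL (λ y → (j ≤ᵇ y) ∧ (y ≤ᵇ nth ν (length A))) (nth ν) (range (length A))) ⟩
  countL (λ y → (j ≤ᵇ y) ∧ (y ≤ᵇ nth ν (length A))) (mapL (nth ν) (range (length A)))
    ≡⟨ cong₂ (λ z ys → countL (λ y → (j ≤ᵇ y) ∧ (y ≤ᵇ z)) ys) (nth-length A x B) (mapL-nth-range A (x ∷ B)) ⟩
  leftArm j x A ∎
  where
  open ≡-Reasoning
  ν = A ++ x ∷ B

rightArm-zipper : ∀ A x B k →
  countL (λ r → (k ≤ᵇ nth (A ++ x ∷ B) r) ∧ (nth (A ++ x ∷ B) r <ᵇ nth (A ++ x ∷ B) (length A)))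
         (rowsAfter (A ++ x ∷ B) (length A))
  ≡ rightArm k x B
rightArm-zipper A x B k = begin
  countL (λ r → (k ≤ᵇ nth ν r) ∧ (nth ν r <ᵇ nth ν (length A))) (rowsAfter ν (length A))
    ≡⟨ sym (countL-mapL (λ y → (k ≤ᵇ y) ∧ (y <ᵇ nth ν (length A))) (nth ν) (rowsAfter ν (length A))) ⟩
  countL (λ y → (k ≤ᵇ y) ∧ (y <ᵇ nth ν (length A))) (mapL (nth ν) (rowsAfter ν (length A)))
    ≡⟨ cong₂ (λ z ys → countL (λ y → (k ≤ᵇ y) ∧ (y <ᵇ z)) ys) (nth-length A x B) (mapL-nth-rowsAfter A x B) ⟩
  rightArm k x B ∎
  where
  open ≡-Reasoning
  ν = A ++ x ∷ B

armTilde-zipper : ∀ A x B j → armTilde (A ++ x ∷ B) (length A) j ≡ tildeArm A x B j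
armTilde-zipper A x B j = cong₂ _+_ (armLeft-zipper A x B j) (rightArm-zipper A x B j)

armA-zipper : ∀ A x B j → armA (A ++ x ∷ B) (length A) j ≡ plainArm A x B j
armA-zipper A x B j = cong₂ _+_ (armLeft-zipper A x B j) (rightArm-zipper A x B (j ∸ 1))

Row : Set
Row = List ℕ → ℕ → List ℕ → ℚ

module _ (q u : ℚ) where

  boxFactor : ℕ → ℕ → ℚ
  boxFactor a e = 1ℚ - q ^ℚ a * u ^ℚ suc e

  tildeRowUpTo : List ℕ → ℕ → List ℕ → ℕ → ℚ
  tildeRowUpTo A x B n = prodℚ (mapL (λ j → boxFactor (x ∸ j) (tildeArm A x B j)) (rangeFrom 1 n))

  tildeRow : Row
  tildeRow A x B = tildeRowUpTo A x B x

  plainRow : Row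
  plainRow A x B = prodℚ (mapL (λ j → boxFactor (suc (x ∸ j)) (plainArm A x B j)) (rangeFrom 1 x))

  tildeBoxes : List ℕ → ℕ → List ℚ
  tildeBoxes ν i = mapL (λ j → boxFactor (legL ν i j) (armTilde ν i j)) (rowBoxes ν i)

  plainBoxes : List ℕ → ℕ → List ℚ
  plainBoxes ν i = mapL (λ j → boxFactor (suc (legL ν i j)) (armA ν i j)) (rowBoxes ν i)

  tildeBoxes-zipper : ∀ A x B → prodℚ (tildeBoxes (A ++ x ∷ B) (length A)) ≡ tildeRow A x B
  tildeBoxes-zipper A x B = cong prodℚ (trans
    (cong (λ n → mapL (λ j → boxFactor (legL ν (length A) j) (armTilde ν (length A) j)) (rangeFrom 1 n)) (nth-length A x B))
    (mapL-cong (All.universal (λ j → cong₂ (λ n e → boxFactor (n ∸ j) e) (nth-length A x B) (armTilde-zipper A x B j)) _)))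
    where ν = A ++ x ∷ B

  plainBoxes-zipper : ∀ A x B → prodℚ (plainBoxes (A ++ x ∷ B) (length A)) ≡ plainRow A x B
  plainBoxes-zipper A x B = cong prodℚ (trans
    (cong (λ n → mapL (λ j → boxFactor (suc (legL ν (length A) j)) (armA ν (length A) j)) (rangeFrom 1 n)) (nth-length A x B))
    (mapL-cong (All.universal (λ j → cong₂ (λ n e → boxFactor (suc (n ∸ j)) e) (nth-length A x B) (armA-zipper A x B j)) _)))
    where ν = A ++ x ∷ B

-- zipProd f A B C multiplies f over the entries x of B, each applied to the entries
-- above x (starting with A) and below x (ending with C).
zipProd : Row → List ℕ → List ℕ → List ℕ → ℚ
zipProd f A []      C = 1ℚ
zipProd f A (x ∷ B) C = f A x (B ++ C) * zipProd f (A ++ x ∷ []) B C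

prodℚ-rows≡zipProd : (rows : List ℕ → ℕ → List ℚ) (f : Row) →
  (∀ A x B → prodℚ (rows (A ++ x ∷ B) (length A)) ≡ f A x B) →
  ∀ A B C → prodℚ (concatMapL (rows (A ++ B ++ C)) (rangeFrom (length A) (length B))) ≡ zipProd f A B C
prodℚ-rows≡zipProd rows f row A []      C = refl
prodℚ-rows≡zipProd rows f row A (x ∷ B) C = trans (prodℚ-++ (rows ν (length A)) _) (cong₂ _*_ (row A x (B ++ C)) below)
  where
  ν = A ++ x ∷ B ++ C
  below : prodℚ (concatMapL (rows ν) (rangeFrom (suc (length A)) (length B))) ≡ zipProd f (A ++ x ∷ []) B C
  below = trans
    (cong₂ (λ ν′ n → prodℚ (concatMapL (rows ν′) (rangeFrom n (length B))))
           (sym (++-assoc A (x ∷ []) (B ++ C))) (sym (length-snoc A x)))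
    (prodℚ-rows≡zipProd rows f row (A ++ x ∷ []) B C)

jPoly≡zipProd : ∀ la ga q u →
  jPoly la ga q u ≡ zipProd (tildeRow q u) [] (sortAsc la) ga * zipProd (plainRow q u) (sortAsc la) ga []
jPoly≡zipProd la ga q u = cong₂ _*_
  (trans (cong (λ n → prodℚ (concatMapL (tildeBoxes q u ν) (range n))) (sym (length-sortAsc la)))
         (prodℚ-rows≡zipProd (tildeBoxes q u) (tildeRow q u) (tildeBoxes-zipper q u) [] (sortAsc la) ga))
  (trans (cong₂ (λ ν′ n → prodℚ (concatMapL (plainBoxes q u ν′) (rangeFrom n (length ga))))
                (cong (sortAsc la ++_) (sym (++-identityʳ ga))) (sym (length-sortAsc la)))
         (prodℚ-rows≡zipProd (plainBoxes q u) (plainRow q u) (plainBoxes-zipper q u) (sortAsc la) ga []))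
  where ν = sortAsc la ++ ga

zipProd-++ : ∀ f A B B′ C → zipProd f A (B ++ B′) C ≡ zipProd f A B (B′ ++ C) * zipProd f (A ++ B) B′ C
zipProd-++ f A []      B′ C =
  sym (trans (ℚ.*-identityˡ _) (cong (λ A′ → zipProd f A′ B′ C) (++-identityʳ A)))
zipProd-++ f A (x ∷ B) B′ C = begin
  f A x ((B ++ B′) ++ C) * zipProd f (A ++ x ∷ []) (B ++ B′) C
    ≡⟨ cong₂ _*_ (cong (f A x) (++-assoc B B′ C)) (zipProd-++ f (A ++ x ∷ []) B B′ C) ⟩
  f A x (B ++ B′ ++ C) * (zipProd f (A ++ x ∷ []) B (B′ ++ C) * zipProd f ((A ++ x ∷ []) ++ B) B′ C)
    ≡⟨ cong (λ A′ → f A x (B ++ B′ ++ C) * (zipProd f (A ++ x ∷ []) B (B′ ++ C) * zipProd f A′ B′ C))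
            (++-assoc A (x ∷ []) B) ⟩
  f A x (B ++ B′ ++ C) * (zipProd f (A ++ x ∷ []) B (B′ ++ C) * zipProd f (A ++ x ∷ B) B′ C)
    ≡⟨ sym (ℚ.*-assoc (f A x (B ++ B′ ++ C)) _ _) ⟩
  f A x (B ++ B′ ++ C) * zipProd f (A ++ x ∷ []) B (B′ ++ C) * zipProd f (A ++ x ∷ B) B′ C ∎
  where open ≡-Reasoning

zipProd-cong : ∀ {P : ℕ → Set} (f g : Row) {A A′ B C C′} → All P B →
  (∀ L x R → P x → f (A ++ L) x (R ++ C) ≡ g (A′ ++ L) x (R ++ C′)) →
  zipProd f A B C ≡ zipProd g A′ B C′
zipProd-cong f g                   []         row = refl
zipProd-cong f g {A} {A′} {x ∷ B} {C} {C′} (px ∷ pB) row = cong₂ _*_ here rest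
  where
  here : f A x (B ++ C) ≡ g A′ x (B ++ C′)
  here = subst₂ (λ A₁ A₂ → f A₁ x (B ++ C) ≡ g A₂ x (B ++ C′)) (++-identityʳ A) (++-identityʳ A′) (row [] x B px)
  rest : zipProd f (A ++ x ∷ []) B C ≡ zipProd g (A′ ++ x ∷ []) B C′
  rest = zipProd-cong f g pB λ L y R py →
    subst₂ (λ A₁ A₂ → f A₁ y (R ++ C) ≡ g A₂ y (R ++ C′))
           (sym (++-assoc A (x ∷ []) L)) (sym (++-assoc A′ (x ∷ []) L)) (row (x ∷ L) y R py)

zipProd-≢0 : ∀ {f} A B C → (∀ A′ x B′ → f A′ x B′ ≢ 0ℚ) → zipProd f A B C ≢ 0ℚ
zipProd-≢0 A []      C f≢0 = ℚ.1≢0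
zipProd-≢0 A (x ∷ B) C f≢0 = *-≢0 (f≢0 A x (B ++ C)) (zipProd-≢0 (A ++ x ∷ []) B C f≢0)

-- Comparing the rows of the two compositions

module _ (q u : ℚ) (c : ℕ) (ga : List ℕ) where

  lowRows : ∀ {low} m → All (_< suc c) low →
    zipProd (tildeRow q u) [] low (replicate m (suc c) ++ ga ++ c ∷ [])
    ≡ zipProd (tildeRow q u) [] low (replicate (suc m) (suc c) ++ ga)
  lowRows m low<v = zipProd-cong (tildeRow q u) (tildeRow q u) low<v λ L x R x<v →
    prodℚ-mapL-cong-range x λ j _ → cong (λ r → boxFactor q u (x ∸ j) (leftArm j x L + r)) (below j x R (s≤s⁻¹ x<v))
    where
    below : ∀ j x R → x ≤ c →
      rightArm j x (R ++ replicate m (suc c) ++ ga ++ c ∷ []) ≡ rightArm j x (R ++ replicate (suc m) (suc c) ++ ga)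
    below j x R x≤c = begin
      rightArm j x (R ++ replicate m (suc c) ++ ga ++ c ∷ [])
        ≡⟨ rightArm-++ j x R _ ⟩
      rightArm j x R + rightArm j x (replicate m (suc c) ++ ga ++ c ∷ [])
        ≡⟨ cong (rightArm j x R +_) (rightArm-replicate-++ j x m _ (m≤n⇒m≤1+n x≤c)) ⟩
      rightArm j x R + rightArm j x (ga ++ c ∷ [])
        ≡⟨ cong (rightArm j x R +_) (trans (rightArm-snoc j x ga c) (cong (λ b → rightArm j x ga + indicator ((j ≤ᵇ c) ∧ b)) (<ᵇ-false x≤c))) ⟩
      rightArm j x R + (rightArm j x ga + indicator ((j ≤ᵇ c) ∧ false))
        ≡⟨ cong (λ b → rightArm j x R + (rightArm j x ga + indicator b)) (∧-zeroʳ (j ≤ᵇ c)) ⟩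
      rightArm j x R + (rightArm j x ga + 0)
        ≡⟨ cong (rightArm j x R +_) (trans (+-identityʳ _) (sym (rightArm-replicate-++ j x (suc m) ga (m≤n⇒m≤1+n x≤c)))) ⟩
      rightArm j x R + rightArm j x (replicate (suc m) (suc c) ++ ga)
        ≡⟨ sym (rightArm-++ j x R _) ⟩
      rightArm j x (R ++ replicate (suc m) (suc c) ++ ga) ∎
      where open ≡-Reasoning

  gammaRows : ∀ A₁ A₂ →
    zipProd (plainRow q u) (A₁ ++ A₂) ga (c ∷ []) ≡ zipProd (plainRow q u) (A₁ ++ suc c ∷ A₂) ga []
  gammaRows A₁ A₂ = zipProd-cong (plainRow q u) (plainRow q u) (All.universal (λ _ → tt) ga) λ L x R _ →
    prodℚ-mapL-cong-range x λ j _ → cong (boxFactor q u (suc (x ∸ j))) (arms L x R j)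
    where
    -- The part c below a row of length x is seen by the box in column j exactly
    -- when the extra part c + 1 above it is.
    arms : ∀ L x R j → plainArm ((A₁ ++ A₂) ++ L) x (R ++ c ∷ []) j ≡ plainArm ((A₁ ++ suc c ∷ A₂) ++ L) x (R ++ []) j
    arms L x R j = begin
      leftArm j x ((A₁ ++ A₂) ++ L) + rightArm (j ∸ 1) x (R ++ c ∷ [])
        ≡⟨ cong₂ _+_ (cong (leftArm j x) (++-assoc A₁ A₂ L)) (countL-insert _ R c []) ⟩
      leftArm j x (A₁ ++ A₂ ++ L) + (indicator ((j ∸ 1 ≤ᵇ c) ∧ (c <ᵇ x)) + rightArm (j ∸ 1) x (R ++ []))
        ≡⟨ cong (λ b → leftArm j x (A₁ ++ A₂ ++ L) + (indicator (b ∧ (c <ᵇ x)) + rightArm (j ∸ 1) x (R ++ []))) (pred≤ᵇ≡≤ᵇsuc j c) ⟩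
      leftArm j x (A₁ ++ A₂ ++ L) + (indicator ((j ≤ᵇ suc c) ∧ (c <ᵇ x)) + rightArm (j ∸ 1) x (R ++ []))
        ≡⟨ +-rotate (leftArm j x (A₁ ++ A₂ ++ L)) (indicator ((j ≤ᵇ suc c) ∧ (c <ᵇ x))) (rightArm (j ∸ 1) x (R ++ [])) ⟩
      indicator ((j ≤ᵇ suc c) ∧ (c <ᵇ x)) + leftArm j x (A₁ ++ A₂ ++ L) + rightArm (j ∸ 1) x (R ++ [])
        ≡⟨ cong (_+ rightArm (j ∸ 1) x (R ++ [])) (sym (countL-insert _ A₁ (suc c) (A₂ ++ L))) ⟩
      leftArm j x (A₁ ++ suc c ∷ A₂ ++ L) + rightArm (j ∸ 1) x (R ++ [])
        ≡⟨ cong (λ A → leftArm j x A + rightArm (j ∸ 1) x (R ++ [])) (sym (++-assoc A₁ (suc c ∷ A₂) L)) ⟩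
      leftArm j x ((A₁ ++ suc c ∷ A₂) ++ L) + rightArm (j ∸ 1) x (R ++ []) ∎
      where
      open ≡-Reasoning

  lastGammaRow : ∀ {low} m → All (_< suc c) low →
    plainRow q u ((low ++ replicate m (suc c)) ++ ga) c [] ≡ tildeRowUpTo q u low (suc c) ga c
  lastGammaRow {low} m low<v = prodℚ-mapL-cong-range c λ j j≤c → cong₂ (boxFactor q u) (sym (+-∸-assoc 1 j≤c)) (arms j)
    where
    arms : ∀ j → plainArm ((low ++ replicate m (suc c)) ++ ga) c [] j ≡ tildeArm low (suc c) ga j
    arms j = begin
      leftArm j c ((low ++ replicate m (suc c)) ++ ga) + 0
        ≡⟨ +-identityʳ _ ⟩
      leftArm j c ((low ++ replicate m (suc c)) ++ ga)
        ≡⟨ trans (leftArm-++ j c (low ++ replicate m (suc c)) ga) (cong (_+ leftArm j c ga) (leftArm-++ j c low (replicate m (suc c)))) ⟩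
      leftArm j c low + leftArm j c (replicate m (suc c)) + leftArm j c ga
        ≡⟨ cong₂ _+_ (cong₂ _+_ lowSame longNone) gaSame ⟩
      leftArm j (suc c) low + 0 + rightArm j (suc c) ga
        ≡⟨ cong (_+ rightArm j (suc c) ga) (+-identityʳ _) ⟩
      tildeArm low (suc c) ga j ∎
      where
      open ≡-Reasoning
      lowSame : leftArm j c low ≡ leftArm j (suc c) low
      lowSame = countL-cong (All.map (λ {y} y<v → cong ((j ≤ᵇ y) ∧_) (trans (≤ᵇ-true (s≤s⁻¹ y<v)) (sym (≤ᵇ-true (<⇒≤ y<v))))) low<v)
      longNone : leftArm j c (replicate m (suc c)) ≡ 0
      longNone = countL-none _ (replicate⁺ m (trans (cong ((j ≤ᵇ suc c) ∧_) (≤ᵇ-false (n<1+n c))) (∧-zeroʳ (j ≤ᵇ suc c))))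
      gaSame : leftArm j c ga ≡ rightArm j (suc c) ga
      gaSame = countL-cong (All.universal (λ y → cong ((j ≤ᵇ y) ∧_) (≤ᵇ≡<ᵇsuc y c)) ga)

  longRowInit : List ℕ → ℚ
  longRowInit A = tildeRowUpTo q u A (suc c) ga c

  longRowLast : List ℕ → ℚ
  longRowLast A = boxFactor q u 0 (tildeArm A (suc c) ga (suc c))

  tildeRow-split : ∀ A B →
    tildeRow q u A (suc c) B ≡ tildeRowUpTo q u A (suc c) B c * boxFactor q u 0 (tildeArm A (suc c) B (suc c))
  tildeRow-split A B = trans (prodℚ-mapL-rangeFrom-suc _ c)
    (cong (λ a → tildeRowUpTo q u A (suc c) B c * boxFactor q u a (tildeArm A (suc c) B (suc c))) (n∸n≡0 c))

  longRow : ∀ A n → tildeRow q u A (suc c) (replicate n (suc c) ++ ga) ≡ longRowInit A * longRowLast A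
  longRow A n = trans (cong prodℚ (mapL-cong (All.universal box (rangeFrom 1 (suc c))))) (tildeRow-split A ga)
    where
    box : ∀ j → boxFactor q u (suc c ∸ j) (tildeArm A (suc c) (replicate n (suc c) ++ ga) j)
              ≡ boxFactor q u (suc c ∸ j) (tildeArm A (suc c) ga j)
    box j = cong (λ r → boxFactor q u (suc c ∸ j) (leftArm j (suc c) A + r)) (rightArm-replicate-++ j (suc c) n ga ≤-refl)

  longRow-above-c : ∀ A n →
    tildeRow q u A (suc c) (replicate n (suc c) ++ ga ++ c ∷ []) ≡ longRowInit (A ++ suc c ∷ []) * longRowLast A
  longRow-above-c A n = trans (tildeRow-split A B) (cong₂ _*_ initPart lastPart)
    where
    open ≡-Reasoning
    B = replicate n (suc c) ++ ga ++ c ∷ []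
    below : ∀ j → rightArm j (suc c) B ≡ rightArm j (suc c) ga + indicator (j ≤ᵇ c)
    below j = begin
      rightArm j (suc c) B
        ≡⟨ trans (rightArm-replicate-++ j (suc c) n _ ≤-refl) (rightArm-snoc j (suc c) ga c) ⟩
      rightArm j (suc c) ga + indicator ((j ≤ᵇ c) ∧ (c <ᵇ suc c))
        ≡⟨ cong (λ b → rightArm j (suc c) ga + indicator ((j ≤ᵇ c) ∧ b)) (<ᵇ-true (n<1+n c)) ⟩
      rightArm j (suc c) ga + indicator ((j ≤ᵇ c) ∧ true)
        ≡⟨ cong (λ b → rightArm j (suc c) ga + indicator b) (∧-identityʳ (j ≤ᵇ c)) ⟩
      rightArm j (suc c) ga + indicator (j ≤ᵇ c) ∎
    initPart : tildeRowUpTo q u A (suc c) B c ≡ longRowInit (A ++ suc c ∷ [])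
    initPart = prodℚ-mapL-cong-range c λ j j≤c → cong (boxFactor q u (suc c ∸ j)) (begin
      leftArm j (suc c) A + rightArm j (suc c) B
        ≡⟨ cong (leftArm j (suc c) A +_) (below j) ⟩
      leftArm j (suc c) A + (rightArm j (suc c) ga + indicator (j ≤ᵇ c))
        ≡⟨ cong (λ b → leftArm j (suc c) A + (rightArm j (suc c) ga + indicator b)) (≤ᵇ-true j≤c) ⟩
      leftArm j (suc c) A + (rightArm j (suc c) ga + 1)
        ≡⟨ +-swapʳ (leftArm j (suc c) A) (rightArm j (suc c) ga) 1 ⟩
      leftArm j (suc c) A + 1 + rightArm j (suc c) ga
        ≡⟨ cong (λ b → leftArm j (suc c) A + indicator b + rightArm j (suc c) ga) (sym (counts-long j≤c)) ⟩
      leftArm j (suc c) A + indicator ((j ≤ᵇ suc c) ∧ (suc c ≤ᵇ suc c)) + rightArm j (suc c) ga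
        ≡⟨ cong (_+ rightArm j (suc c) ga) (sym (leftArm-++ j (suc c) A (suc c ∷ []))) ⟩
      leftArm j (suc c) (A ++ suc c ∷ []) + rightArm j (suc c) ga ∎)
      where
      counts-long : ∀ {j} → j ≤ c → ((j ≤ᵇ suc c) ∧ (suc c ≤ᵇ suc c)) ≡ true
      counts-long j≤c = cong₂ _∧_ (≤ᵇ-true (m≤n⇒m≤1+n j≤c)) (≤ᵇ-true (≤-refl {suc c}))
    lastPart : boxFactor q u 0 (tildeArm A (suc c) B (suc c)) ≡ longRowLast A
    lastPart = cong (λ r → boxFactor q u 0 (leftArm (suc c) (suc c) A + r)) (begin
      rightArm (suc c) (suc c) B                                ≡⟨ below (suc c) ⟩
      rightArm (suc c) (suc c) ga + indicator (suc c ≤ᵇ c)      ≡⟨ cong (λ b → rightArm (suc c) (suc c) ga + indicator b) (≤ᵇ-false (n<1+n c)) ⟩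
      rightArm (suc c) (suc c) ga + 0                           ≡⟨ +-identityʳ _ ⟩
      rightArm (suc c) (suc c) ga                               ∎)

  longRows : ∀ n A →
    zipProd (tildeRow q u) A (replicate n (suc c)) (ga ++ c ∷ []) * longRowInit A * longRowLast (A ++ replicate n (suc c))
    ≡ zipProd (tildeRow q u) A (replicate (suc n) (suc c)) ga
  longRows zero A = begin
    1ℚ * longRowInit A * longRowLast (A ++ [])  ≡⟨ cong (λ A′ → 1ℚ * longRowInit A * longRowLast A′) (++-identityʳ A) ⟩
    1ℚ * longRowInit A * longRowLast A          ≡⟨ unit (longRowInit A) (longRowLast A) ⟩
    longRowInit A * longRowLast A * 1ℚ          ≡⟨ cong (_* 1ℚ) (sym (longRow A 0)) ⟩
    tildeRow q u A (suc c) ga * 1ℚ              ∎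
    where
    open ≡-Reasoning
    unit : ∀ a b → 1ℚ * a * b ≡ a * b * 1ℚ
    unit = solve-∀ ℚ-ring
  longRows (suc n) A = begin
    tildeRow q u A (suc c) (replicate n (suc c) ++ ga ++ c ∷ []) * Z * longRowInit A * longRowLast (A ++ replicate (suc n) (suc c))
      ≡⟨ cong (λ r → r * Z * longRowInit A * longRowLast (A ++ replicate (suc n) (suc c))) (longRow-above-c A n) ⟩
    longRowInit A′ * longRowLast A * Z * longRowInit A * longRowLast (A ++ replicate (suc n) (suc c))
      ≡⟨ regroup (longRowInit A′) (longRowLast A) Z (longRowInit A) _ ⟩
    longRowInit A * longRowLast A * (Z * longRowInit A′ * longRowLast (A ++ replicate (suc n) (suc c)))
      ≡⟨ cong₂ _*_ (sym (longRow A (suc n)))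
                   (trans (cong (λ A″ → Z * longRowInit A′ * longRowLast A″) (sym (++-assoc A (suc c ∷ []) (replicate n (suc c)))))
                          (longRows n A′)) ⟩
    tildeRow q u A (suc c) (replicate (suc n) (suc c) ++ ga) * zipProd (tildeRow q u) A′ (replicate (suc n) (suc c)) ga ∎
    where
    open ≡-Reasoning
    A′ = A ++ suc c ∷ []
    Z = zipProd (tildeRow q u) A′ (replicate n (suc c)) (ga ++ c ∷ [])
    regroup : ∀ i′ l z i l′ → i′ * l * z * i * l′ ≡ i * l * (z * i′ * l′)
    regroup = solve-∀ ℚ-ring

  longRowLast-value : ∀ {low} m → All (_< suc c) low → longRowLast (low ++ replicate m (suc c)) ≡ 1ℚ - u ^ℚ suc m
  longRowLast-value {low} m low<v = begin
    boxFactor q u 0 (leftArm (suc c) (suc c) (low ++ replicate m (suc c)) + rightArm (suc c) (suc c) ga)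
      ≡⟨ cong (boxFactor q u 0) arm ⟩
    1ℚ - 1ℚ * u ^ℚ suc m
      ≡⟨ cong (λ p → 1ℚ - p) (ℚ.*-identityˡ (u ^ℚ suc m)) ⟩
    1ℚ - u ^ℚ suc m ∎
    where
    open ≡-Reasoning
    arm : leftArm (suc c) (suc c) (low ++ replicate m (suc c)) + rightArm (suc c) (suc c) ga ≡ m
    arm = begin
      leftArm (suc c) (suc c) (low ++ replicate m (suc c)) + rightArm (suc c) (suc c) ga
        ≡⟨ cong₂ _+_ (leftArm-++ (suc c) (suc c) low (replicate m (suc c))) (rightArm-self (suc c) ga) ⟩
      leftArm (suc c) (suc c) low + leftArm (suc c) (suc c) (replicate m (suc c)) + 0
        ≡⟨ +-identityʳ _ ⟩
      leftArm (suc c) (suc c) low + leftArm (suc c) (suc c) (replicate m (suc c))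
        ≡⟨ cong₂ _+_ (countL-none _ (All.map (λ {y} y<v → cong (_∧ (y ≤ᵇ suc c)) (≤ᵇ-false y<v)) low<v))
                     (countL-replicate _ m (cong₂ _∧_ (≤ᵇ-true (≤-refl {suc c})) (≤ᵇ-true (≤-refl {suc c})))) ⟩
      m ∎

  jPoly-shift : ∀ {la} → All (_≤ suc c) la →
    jPoly (suc c ∷ la) ga q u ≡ jPoly la (ga ++ c ∷ []) q u * (1ℚ - u ^ℚ suc (mult (suc c) la))
  jPoly-shift {la} la≤v with sortAsc-split la la≤v
  ... | low , low<v , sorted = begin
    jPoly (suc c ∷ la) ga q u
      ≡⟨ upper ⟩
    Low * (Long * longRowInit low * longRowLast (low ++ long m)) * Γ
      ≡⟨ cong₂ (λ i l → Low * (Long * i * l) * Γ) (sym (lastGammaRow m low<v)) (longRowLast-value m low<v) ⟩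
    Low * (Long * Last * (1ℚ - u ^ℚ suc m)) * Γ
      ≡⟨ regroup Low Long Last (1ℚ - u ^ℚ suc m) Γ ⟩
    Low * Long * (Γ * (Last * 1ℚ)) * (1ℚ - u ^ℚ suc m)
      ≡⟨ cong (_* (1ℚ - u ^ℚ suc m)) (sym lower) ⟩
    jPoly la (ga ++ c ∷ []) q u * (1ℚ - u ^ℚ suc m) ∎
    where
    open ≡-Reasoning
    m = mult (suc c) la
    long : ℕ → List ℕ
    long n = replicate n (suc c)
    Low  = zipProd (tildeRow q u) [] low (long m ++ ga ++ c ∷ [])
    Long = zipProd (tildeRow q u) low (long m) (ga ++ c ∷ [])
    Γ    = zipProd (plainRow q u) (low ++ long m) ga (c ∷ [])
    Last = plainRow q u ((low ++ long m) ++ ga) c []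

    lower : jPoly la (ga ++ c ∷ []) q u ≡ Low * Long * (Γ * (Last * 1ℚ))
    lower = begin
      jPoly la (ga ++ c ∷ []) q u
        ≡⟨ jPoly≡zipProd la (ga ++ c ∷ []) q u ⟩
      zipProd (tildeRow q u) [] (sortAsc la) (ga ++ c ∷ []) * zipProd (plainRow q u) (sortAsc la) (ga ++ c ∷ []) []
        ≡⟨ cong (λ ν → zipProd (tildeRow q u) [] ν (ga ++ c ∷ []) * zipProd (plainRow q u) ν (ga ++ c ∷ []) []) sorted ⟩
      zipProd (tildeRow q u) [] (low ++ long m) (ga ++ c ∷ []) * zipProd (plainRow q u) (low ++ long m) (ga ++ c ∷ []) []
        ≡⟨ cong₂ _*_ (zipProd-++ (tildeRow q u) [] low (long m) (ga ++ c ∷ []))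
                     (zipProd-++ (plainRow q u) (low ++ long m) ga (c ∷ []) []) ⟩
      Low * Long * (Γ * (Last * 1ℚ)) ∎

    upper : jPoly (suc c ∷ la) ga q u ≡ Low * (Long * longRowInit low * longRowLast (low ++ long m)) * Γ
    upper = begin
      jPoly (suc c ∷ la) ga q u
        ≡⟨ jPoly≡zipProd (suc c ∷ la) ga q u ⟩
      zipProd (tildeRow q u) [] (insertAsc (suc c) (sortAsc la)) ga * zipProd (plainRow q u) (insertAsc (suc c) (sortAsc la)) ga []
        ≡⟨ cong (λ ν → zipProd (tildeRow q u) [] ν ga * zipProd (plainRow q u) ν ga [])
                (trans (cong (insertAsc (suc c)) sorted) (insertAsc-top low m low<v)) ⟩
      zipProd (tildeRow q u) [] (low ++ long (suc m)) ga * zipProd (plainRow q u) (low ++ long (suc m)) ga []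
        ≡⟨ cong (_* zipProd (plainRow q u) (low ++ long (suc m)) ga []) (zipProd-++ (tildeRow q u) [] low (long (suc m)) ga) ⟩
      zipProd (tildeRow q u) [] low (long (suc m) ++ ga) * zipProd (tildeRow q u) low (long (suc m)) ga
        * zipProd (plainRow q u) (low ++ long (suc m)) ga []
        ≡⟨ cong₂ _*_ (cong₂ _*_ (sym (lowRows m low<v)) (sym (longRows m low))) (sym (gammaRows low (long m))) ⟩
      Low * (Long * longRowInit low * longRowLast (low ++ long m)) * Γ ∎

    regroup : ∀ l t z x g → l * (t * z * x) * g ≡ l * t * (g * (z * 1ℚ)) * x
    regroup = solve-∀ ℚ-ring

-- The exponent

nStat-∷ : ∀ y L → nStat (y ∷ L) ≡ sumℕ L + nStat L
nStat-∷ y L = begin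
  sumℕ (mapL (λ i → i ℕ.* nth (y ∷ L) i) (rangeFrom 1 (length L)))
    ≡⟨ cong sumℕ (mapL-rangeFrom-suc (λ i → i ℕ.* nth (y ∷ L) i) 0 (length L)) ⟩
  sumℕ (mapL (λ i → nth L i + i ℕ.* nth L i) (range (length L)))
    ≡⟨ sumℕ-mapL-+ (nth L) (λ i → i ℕ.* nth L i) (range (length L)) ⟩
  sumℕ (mapL (nth L) (range (length L))) + nStat L
    ≡⟨ cong (λ L′ → sumℕ L′ + nStat L) (mapL-nth-all L) ⟩
  sumℕ L + nStat L ∎
  where open ≡-Reasoning

minSum : ℕ → List ℕ → ℕ
minSum x []       = 0
minSum x (y ∷ ys) = x ⊓ y + minSum x ys

pairMinSum : List ℕ → ℕ
pairMinSum []       = 0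
pairMinSum (x ∷ xs) = minSum x xs + pairMinSum xs

SortedDesc : List ℕ → Set
SortedDesc = AllPairs (λ x y → y ≤ x)

insertDesc-All : ∀ {P : ℕ → Set} {x} ys → P x → All P ys → All P (insertDesc x ys)
insertDesc-All         []       px []         = px ∷ []
insertDesc-All {x = x} (y ∷ ys) px (py ∷ pys) with y ≤ᵇ x
... | true  = px ∷ py ∷ pys
... | false = py ∷ insertDesc-All ys px pys

insertDesc-sorted : ∀ x {ys} → SortedDesc ys → SortedDesc (insertDesc x ys)
insertDesc-sorted x {[]}     []            = [] ∷ []
insertDesc-sorted x {y ∷ ys} (y≥ys ∷ sorted) with y ≤ᵇ x in y≤ᵇx
... | true  = (y≤x ∷ All.map (λ z≤y → ≤-trans z≤y y≤x) y≥ys) ∷ y≥ys ∷ sorted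
  where y≤x = ≤ᵇ≡true⇒≤ y≤ᵇx
... | false = insertDesc-All ys (<⇒≤ (≤ᵇ≡false⇒> y≤ᵇx)) y≥ys ∷ insertDesc-sorted x sorted

sortDesc-sorted : ∀ xs → SortedDesc (sortDesc xs)
sortDesc-sorted []       = []
sortDesc-sorted (x ∷ xs) = insertDesc-sorted x (sortDesc-sorted xs)

sumℕ-insertDesc : ∀ x ys → sumℕ (insertDesc x ys) ≡ x + sumℕ ys
sumℕ-insertDesc x []       = refl
sumℕ-insertDesc x (y ∷ ys) with y ≤ᵇ x
... | true  = refl
... | false = trans (cong (y +_) (sumℕ-insertDesc x ys)) (+-left-comm y x (sumℕ ys))

minSum-insertDesc : ∀ z x ys → minSum z (insertDesc x ys) ≡ z ⊓ x + minSum z ys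
minSum-insertDesc z x []       = refl
minSum-insertDesc z x (y ∷ ys) with y ≤ᵇ x
... | true  = refl
... | false = trans (cong (z ⊓ y +_) (minSum-insertDesc z x ys)) (+-left-comm (z ⊓ y) (z ⊓ x) (minSum z ys))

minSum-sortDesc : ∀ z xs → minSum z (sortDesc xs) ≡ minSum z xs
minSum-sortDesc z []       = refl
minSum-sortDesc z (x ∷ xs) = trans (minSum-insertDesc z x (sortDesc xs)) (cong (z ⊓ x +_) (minSum-sortDesc z xs))

minSum-≤ : ∀ {x ys} → All (_≤ x) ys → minSum x ys ≡ sumℕ ys
minSum-≤ []           = refl
minSum-≤ (y≤x ∷ ys≤x) = cong₂ _+_ (m≥n⇒m⊓n≡n y≤x) (minSum-≤ ys≤x)

nStat-insertDesc : ∀ x {ys} → SortedDesc ys → nStat (insertDesc x ys) ≡ minSum x ys + nStat ys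
nStat-insertDesc x {[]}     []            = refl
nStat-insertDesc x {y ∷ ys} (y≥ys ∷ sorted) with y ≤ᵇ x in y≤ᵇx
... | true  = trans (nStat-∷ x (y ∷ ys)) (cong (_+ nStat (y ∷ ys)) (sym (minSum-≤ (y≤x ∷ ys≤x))))
  where
  y≤x = ≤ᵇ≡true⇒≤ y≤ᵇx
  ys≤x = All.map (λ z≤y → ≤-trans z≤y y≤x) y≥ys
... | false = begin
  nStat (y ∷ insertDesc x ys)
    ≡⟨ nStat-∷ y (insertDesc x ys) ⟩
  sumℕ (insertDesc x ys) + nStat (insertDesc x ys)
    ≡⟨ cong₂ _+_ (sumℕ-insertDesc x ys) (nStat-insertDesc x sorted) ⟩
  x + sumℕ ys + (minSum x ys + nStat ys)
    ≡⟨ +-interchange x (sumℕ ys) (minSum x ys) (nStat ys) ⟩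
  x + minSum x ys + (sumℕ ys + nStat ys)
    ≡⟨ cong₂ (λ m n → m + minSum x ys + n) (sym (m≤n⇒m⊓n≡m x≤y)) (sym (nStat-∷ y ys)) ⟩
  x ⊓ y + minSum x ys + nStat (y ∷ ys) ∎
  where
  open ≡-Reasoning
  x≤y = <⇒≤ (≤ᵇ≡false⇒> y≤ᵇx)

nStat-sortDesc : ∀ xs → nStat (sortDesc xs) ≡ pairMinSum xs
nStat-sortDesc []       = refl
nStat-sortDesc (x ∷ xs) = trans (nStat-insertDesc x (sortDesc-sorted xs))
  (cong₂ _+_ (minSum-sortDesc x xs) (nStat-sortDesc xs))

minSum-++ : ∀ x ys zs → minSum x (ys ++ zs) ≡ minSum x ys + minSum x zs
minSum-++ x []       zs = refl
minSum-++ x (y ∷ ys) zs = trans (cong (x ⊓ y +_) (minSum-++ x ys zs)) (sym (+-assoc (x ⊓ y) _ _))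

pairMinSum-snoc : ∀ xs z → pairMinSum (xs ++ z ∷ []) ≡ pairMinSum xs + minSum z xs
pairMinSum-snoc []       z = refl
pairMinSum-snoc (x ∷ xs) z = begin
  minSum x (xs ++ z ∷ []) + pairMinSum (xs ++ z ∷ [])
    ≡⟨ cong₂ _+_ (minSum-++ x xs (z ∷ [])) (pairMinSum-snoc xs z) ⟩
  minSum x xs + (x ⊓ z + 0) + (pairMinSum xs + minSum z xs)
    ≡⟨ cong (λ w → minSum x xs + (w + 0) + (pairMinSum xs + minSum z xs)) (⊓-comm x z) ⟩
  minSum x xs + (z ⊓ x + 0) + (pairMinSum xs + minSum z xs)
    ≡⟨ shuffle (minSum x xs) (z ⊓ x) (pairMinSum xs) (minSum z xs) ⟩
  minSum x xs + pairMinSum xs + (z ⊓ x + minSum z xs) ∎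
  where
  open ≡-Reasoning
  shuffle : ∀ a w p b → a + (w + 0) + (p + b) ≡ a + p + (w + b)
  shuffle = ℕ-Solver.solve-∀

suc⊓ : ∀ c y → suc c ⊓ y ≡ c ⊓ y + indicator (c <ᵇ y)
suc⊓ zero    zero    = refl
suc⊓ (suc c) zero    = refl
suc⊓ zero    (suc y) = refl
suc⊓ (suc c) (suc y) = cong suc (suc⊓ c y)

minSum-suc : ∀ c ys → minSum (suc c) ys ≡ minSum c ys + countL (c <ᵇ_) ys
minSum-suc c []       = refl
minSum-suc c (y ∷ ys) = begin
  suc c ⊓ y + minSum (suc c) ys
    ≡⟨ cong₂ _+_ (suc⊓ c y) (minSum-suc c ys) ⟩
  c ⊓ y + indicator (c <ᵇ y) + (minSum c ys + countL (c <ᵇ_) ys)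
    ≡⟨ +-interchange (c ⊓ y) (indicator (c <ᵇ y)) (minSum c ys) _ ⟩
  c ⊓ y + minSum c ys + (indicator (c <ᵇ y) + countL (c <ᵇ_) ys)
    ≡⟨ cong (c ⊓ y + minSum c ys +_) (sym (countL-∷ (c <ᵇ_) y ys)) ⟩
  minSum c (y ∷ ys) + countL (c <ᵇ_) (y ∷ ys) ∎
  where
  open ≡-Reasoning

invStat-snoc : ∀ xs c → invStat (xs ++ c ∷ []) ≡ invStat xs + countL (c <ᵇ_) xs
invStat-snoc []       c = refl
invStat-snoc (x ∷ xs) c = begin
  countL (_<ᵇ x) (xs ++ c ∷ []) + invStat (xs ++ c ∷ [])
    ≡⟨ cong₂ _+_ (countL-++ (_<ᵇ x) xs (c ∷ [])) (invStat-snoc xs c) ⟩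
  countL (_<ᵇ x) xs + indicator (c <ᵇ x) + (invStat xs + countL (c <ᵇ_) xs)
    ≡⟨ +-interchange (countL (_<ᵇ x) xs) (indicator (c <ᵇ x)) (invStat xs) _ ⟩
  countL (_<ᵇ x) xs + invStat xs + (indicator (c <ᵇ x) + countL (c <ᵇ_) xs)
    ≡⟨ cong (invStat (x ∷ xs) +_) (sym (countL-∷ (c <ᵇ_) x xs)) ⟩
  invStat (x ∷ xs) + countL (c <ᵇ_) (x ∷ xs) ∎
  where
  open ≡-Reasoning

countL-<ᵇ≡mult : ∀ c {la} → All (_≤ suc c) la → countL (c <ᵇ_) la ≡ mult (suc c) la
countL-<ᵇ≡mult c la≤v = countL-cong (All.map (λ {x} x≤v → sym (cong (_∧ (c <ᵇ x)) (≤ᵇ-true x≤v))) la≤v)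

gExponent : List ℕ → List ℕ → ℕ
gExponent la ga = invStat ga + nStat (sortLG la ga) + sumℕ la + sumℕ ga

gExponent-shift : ∀ c {la} ga → All (_≤ suc c) la →
  gExponent (suc c ∷ la) ga ≡ gExponent la (ga ++ c ∷ []) + suc (mult (suc c) la)
gExponent-shift c {la} ga la≤v = begin
  invStat ga + nStat (sortDesc (suc c ∷ xs)) + (suc c + sumℕ la) + sumℕ ga
    ≡⟨ cong (λ n → invStat ga + n + (suc c + sumℕ la) + sumℕ ga) upper ⟩
  invStat ga + (minSum c xs + (mult (suc c) la + countL (c <ᵇ_) ga) + pairMinSum xs) + (suc c + sumℕ la) + sumℕ ga
    ≡⟨ shuffle (invStat ga) (minSum c xs) (mult (suc c) la) (countL (c <ᵇ_) ga) (pairMinSum xs) c (sumℕ la) (sumℕ ga) ⟩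
  invStat ga + countL (c <ᵇ_) ga + (pairMinSum xs + minSum c xs) + sumℕ la + (sumℕ ga + (c + 0)) + suc (mult (suc c) la)
    ≡⟨ cong (_+ suc (mult (suc c) la)) (sym lower) ⟩
  gExponent la (ga ++ c ∷ []) + suc (mult (suc c) la) ∎
  where
  open ≡-Reasoning
  xs = la ++ ga
  upper : nStat (sortDesc (suc c ∷ xs)) ≡ minSum c xs + (mult (suc c) la + countL (c <ᵇ_) ga) + pairMinSum xs
  upper = begin
    nStat (sortDesc (suc c ∷ xs))
      ≡⟨ nStat-sortDesc (suc c ∷ xs) ⟩
    minSum (suc c) xs + pairMinSum xs
      ≡⟨ cong (_+ pairMinSum xs) (minSum-suc c xs) ⟩
    minSum c xs + countL (c <ᵇ_) xs + pairMinSum xs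
      ≡⟨ cong (λ n → minSum c xs + n + pairMinSum xs)
              (trans (countL-++ (c <ᵇ_) la ga) (cong (_+ countL (c <ᵇ_) ga) (countL-<ᵇ≡mult c la≤v))) ⟩
    minSum c xs + (mult (suc c) la + countL (c <ᵇ_) ga) + pairMinSum xs ∎
  lower : gExponent la (ga ++ c ∷ [])
          ≡ invStat ga + countL (c <ᵇ_) ga + (pairMinSum xs + minSum c xs) + sumℕ la + (sumℕ ga + (c + 0))
  lower = begin
    invStat (ga ++ c ∷ []) + nStat (sortDesc (la ++ ga ++ c ∷ [])) + sumℕ la + sumℕ (ga ++ c ∷ [])
      ≡⟨ cong₂ (λ i n → i + n + sumℕ la + sumℕ (ga ++ c ∷ [])) (invStat-snoc ga c)
               (trans (cong (λ ys → nStat (sortDesc ys)) (sym (++-assoc la ga (c ∷ []))))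
                      (trans (nStat-sortDesc (xs ++ c ∷ [])) (pairMinSum-snoc xs c))) ⟩
    invStat ga + countL (c <ᵇ_) ga + (pairMinSum xs + minSum c xs) + sumℕ la + sumℕ (ga ++ c ∷ [])
      ≡⟨ cong (invStat ga + countL (c <ᵇ_) ga + (pairMinSum xs + minSum c xs) + sumℕ la +_) (sumℕ-++ ga (c ∷ [])) ⟩
    invStat ga + countL (c <ᵇ_) ga + (pairMinSum xs + minSum c xs) + sumℕ la + (sumℕ ga + (c + 0)) ∎
  shuffle : ∀ i s m k p c l g →
    i + (s + (m + k) + p) + (suc c + l) + g ≡ i + k + (p + s) + l + (g + (c + 0)) + suc m
  shuffle = ℕ-Solver.solve-∀

-- The multiplicity factor

tPochhammer : ℚ → ℕ → ℚ
tPochhammer t n = prodℚ (mapL (λ j → 1ℚ - t ^ℚ j) (rangeFrom 1 n))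

multFactor≡ : ∀ μ t → multFactor μ t ≡ prodℚ (mapL (λ i → tPochhammer t (mult i μ)) (rangeFrom 1 (sumℕ μ)))
multFactor≡ μ t = prodℚ-concatMapL (λ i → mapL (λ j → 1ℚ - t ^ℚ j) (rangeFrom 1 (mult i μ))) (rangeFrom 1 (sumℕ μ))

parts≤sumℕ : ∀ xs → All (_≤ sumℕ xs) xs
parts≤sumℕ []       = []
parts≤sumℕ (x ∷ xs) = m≤m+n x (sumℕ xs) ∷ All.map (λ y≤s → ≤-trans y≤s (m≤n+m (sumℕ xs) x)) (parts≤sumℕ xs)

mult-above-sum : ∀ {i} la → sumℕ la < i → mult i la ≡ 0
mult-above-sum {i} la S<i =
  countL-none _ (All.map (λ {y} y≤S → trans (cong ((y ≤ᵇ i) ∧_) (≤ᵇ-false (≤-<-trans y≤S S<i))) (∧-zeroʳ _)) (parts≤sumℕ la))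

multFactor-range : ∀ la t k →
  prodℚ (mapL (λ i → tPochhammer t (mult i la)) (rangeFrom 1 (sumℕ la + k))) ≡ multFactor la t
multFactor-range la t k = begin
  prodℚ (mapL F (rangeFrom 1 (sumℕ la + k)))
    ≡⟨ cong (λ r → prodℚ (mapL F r)) (rangeFrom-+ 1 (sumℕ la) k) ⟩
  prodℚ (mapL F (rangeFrom 1 (sumℕ la) ++ rangeFrom (suc (sumℕ la)) k))
    ≡⟨ trans (cong prodℚ (mapL-++ F (rangeFrom 1 (sumℕ la)) _)) (prodℚ-++ (mapL F (rangeFrom 1 (sumℕ la))) _) ⟩
  prodℚ (mapL F (rangeFrom 1 (sumℕ la))) * prodℚ (mapL F (rangeFrom (suc (sumℕ la)) k))
    ≡⟨ cong (prodℚ (mapL F (rangeFrom 1 (sumℕ la))) *_) (prodℚ-mapL-ones beyond) ⟩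
  prodℚ (mapL F (rangeFrom 1 (sumℕ la))) * 1ℚ
    ≡⟨ trans (ℚ.*-identityʳ _) (sym (multFactor≡ la t)) ⟩
  multFactor la t ∎
  where
  open ≡-Reasoning
  F = λ i → tPochhammer t (mult i la)
  beyond : All (λ i → F i ≡ 1ℚ) (rangeFrom (suc (sumℕ la)) k)
  beyond = All.map (λ (S<i , _) → cong (tPochhammer t) (mult-above-sum la S<i)) (rangeFrom-bounds (suc (sumℕ la)) k)

multFactor-shift : ∀ c la t →
  multFactor (suc c ∷ la) t ≡ multFactor la t * (1ℚ - t ^ℚ suc (mult (suc c) la))
multFactor-shift c la t = begin
  multFactor (suc c ∷ la) t
    ≡⟨ multFactor≡ (suc c ∷ la) t ⟩
  prodℚ (mapL (λ i → tPochhammer t (mult i (suc c ∷ la))) (rangeFrom 1 (suc c + sumℕ la)))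
    ≡⟨ prodℚ-mapL-update 1 (suc c + sumℕ la) (s≤s z≤n) (s≤s (m≤m+n (suc c) (sumℕ la)))
         (λ i i≢c+1 → cong (tPochhammer t) (mult-∷-≢ la (≢-sym i≢c+1)))
         (trans (cong (tPochhammer t) (mult-∷-self (suc c) la)) (prodℚ-mapL-rangeFrom-suc _ (mult (suc c) la))) ⟩
  prodℚ (mapL (λ i → tPochhammer t (mult i la)) (rangeFrom 1 (suc c + sumℕ la))) * (1ℚ - t ^ℚ suc (mult (suc c) la))
    ≡⟨ cong (_* (1ℚ - t ^ℚ suc (mult (suc c) la)))
         (trans (cong (λ n → prodℚ (mapL (λ i → tPochhammer t (mult i la)) (rangeFrom 1 n))) (+-comm (suc c) (sumℕ la)))
                (multFactor-range la t (suc c))) ⟩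
  multFactor la t * (1ℚ - t ^ℚ suc (mult (suc c) la)) ∎
  where open ≡-Reasoning

gFun-shift : ∀ c {la} ga q t → All (_≤ suc c) la → t ≢ 0ℚ → gFun (suc c ∷ la) ga q t ≢ 0ℚ →
  - (gFun la (ga ++ c ∷ []) q t ÷₀ gFun (suc c ∷ la) ga q t) ≡ 1ℚ
gFun-shift c {la} ga q t la≤v t≢0 =
  neg-ratio {N₁ = J * t ^ℚ E} {M₁ = multFactor la t} numerator (multFactor-shift c la t)
  where
  open ≡-Reasoning
  u = 1ℚ ÷₀ t
  k = suc (mult (suc c) la)
  J = jPoly la (ga ++ c ∷ []) q u
  E = gExponent la (ga ++ c ∷ [])
  regroup : ∀ j x e y → j * x * (e * y) ≡ j * e * (x * y)
  regroup = solve-∀ ℚ-ring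
  pull-neg : ∀ a b → a * - b ≡ - (a * b)
  pull-neg = solve-∀ ℚ-ring
  numerator : jPoly (suc c ∷ la) ga q u * t ^ℚ gExponent (suc c ∷ la) ga ≡ - (J * t ^ℚ E * (1ℚ - t ^ℚ k))
  numerator = begin
    jPoly (suc c ∷ la) ga q u * t ^ℚ gExponent (suc c ∷ la) ga
      ≡⟨ cong₂ _*_ (jPoly-shift q u c ga la≤v) (trans (cong (t ^ℚ_) (gExponent-shift c ga la≤v)) (^ℚ-+ t E k)) ⟩
    J * (1ℚ - u ^ℚ k) * (t ^ℚ E * t ^ℚ k)
      ≡⟨ regroup J (1ℚ - u ^ℚ k) (t ^ℚ E) (t ^ℚ k) ⟩
    J * t ^ℚ E * ((1ℚ - u ^ℚ k) * t ^ℚ k)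
      ≡⟨ cong (J * t ^ℚ E *_) (complement-reciprocal (u ^ℚ k) (t ^ℚ k) (^ℚ-inverse k t≢0)) ⟩
    J * t ^ℚ E * - (1ℚ - t ^ℚ k)
      ≡⟨ pull-neg (J * t ^ℚ E) (1ℚ - t ^ℚ k) ⟩
    - (J * t ^ℚ E * (1ℚ - t ^ℚ k)) ∎

½^≤1 : ∀ n → ½ ^ℚ n ≤ℚ 1ℚ
½^≤1 zero    = ℚ.≤-refl
½^≤1 (suc n) = ℚ.≤-trans (ℚ.*-monoˡ-≤-nonNeg ½ (½^≤1 n)) (toWitness {a? = ½ * 1ℚ ℚ.≤? 1ℚ} tt)

½^suc≢1 : ∀ n → ½ ^ℚ suc n ≢ 1ℚ
½^suc≢1 n ½^suc≡1 =
  ℚ.<-irrefl ½^suc≡1 (ℚ.≤-<-trans (ℚ.*-monoˡ-≤-nonNeg ½ (½^≤1 n)) (toWitness {a? = ½ * 1ℚ ℚ.<? 1ℚ} tt))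

½≢0 : ½ ≢ 0ℚ
½≢0 ()

2^suc≢1 : ∀ n → (1ℚ ÷₀ ½) ^ℚ suc n ≢ 1ℚ
2^suc≢1 n 2^suc≡1 = ½^suc≢1 n (begin
  ½ ^ℚ suc n                          ≡⟨ sym (ℚ.*-identityˡ _) ⟩
  1ℚ * ½ ^ℚ suc n                     ≡⟨ cong (_* ½ ^ℚ suc n) (sym 2^suc≡1) ⟩
  (1ℚ ÷₀ ½) ^ℚ suc n * ½ ^ℚ suc n     ≡⟨ ^ℚ-inverse (suc n) ½≢0 ⟩
  1ℚ                                  ∎)
  where open ≡-Reasoning

jPoly-≢0 : ∀ la ga → jPoly la ga (1ℚ ÷₀ ½) (1ℚ ÷₀ ½) ≢ 0ℚ
jPoly-≢0 la ga = subst (_≢ 0ℚ) (sym (jPoly≡zipProd la ga u u))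
  (*-≢0 (zipProd-≢0 [] (sortAsc la) ga tildeRow≢0) (zipProd-≢0 (sortAsc la) ga [] plainRow≢0))
  where
  u = 1ℚ ÷₀ ½
  box≢0 : ∀ a e → boxFactor u u a e ≢ 0ℚ
  box≢0 a e = 1-x≢0 (subst (_≢ 1ℚ) (trans (cong (u ^ℚ_) (sym (+-suc a e))) (^ℚ-+ u a (suc e))) (2^suc≢1 (a + e)))
  tildeRow≢0 : ∀ A x B → tildeRow u u A x B ≢ 0ℚ
  tildeRow≢0 A x B = prodℚ-mapL-≢0 (All.universal (λ j → box≢0 (x ∸ j) (tildeArm A x B j)) (rangeFrom 1 x))
  plainRow≢0 : ∀ A x B → plainRow u u A x B ≢ 0ℚ
  plainRow≢0 A x B = prodℚ-mapL-≢0 (All.universal (λ j → box≢0 (suc (x ∸ j)) (plainArm A x B j)) (rangeFrom 1 x))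

multFactor-≢0 : ∀ la → multFactor la ½ ≢ 0ℚ
multFactor-≢0 la = subst (_≢ 0ℚ) (sym (multFactor≡ la ½))
  (prodℚ-mapL-≢0 {f = λ i → tPochhammer ½ (mult i la)}
    (All.universal (λ i → prodℚ-mapL-≢0 (All.map factor≢0 (rangeFrom-bounds 1 (mult i la)))) (rangeFrom 1 (sumℕ la))))
  where
  factor≢0 : ∀ {n j} → 1 ≤ j × j < 1 + n → 1ℚ - ½ ^ℚ j ≢ 0ℚ
  factor≢0 {j = suc j} _ = 1-x≢0 (½^suc≢1 j)

-- At t = ½ and q = 1/t = 2 every factor of j is 1 - 2^(a+b+1) and every factor of the
-- multiplicity product is 1 - 2^(-j) with j ≥ 1, so none vanishes.
gFun-≢0 : ∀ la ga → gFun la ga (1ℚ ÷₀ ½) ½ ≢ 0ℚ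
gFun-≢0 la ga = ÷₀-≢0 (*-≢0 (jPoly-≢0 la ga) (^ℚ-≢0 (gExponent la ga) ½≢0)) (multFactor-≢0 la)

proposition6p8 : (la : List ℕ) → IsPartition la → (ga : List ℕ) (c : ℕ) →
    head0 la ≤ suc c →
    (∃₂ λ q t → gFun (suc c ∷ la) ga q t ≢ 0ℚ)
    × ((q t : ℚ) → t ≢ 0ℚ → t ≢ 1ℚ → t ≢ - 1ℚ →
        gFun (suc c ∷ la) ga q t ≢ 0ℚ →
        - (gFun la (ga ++ c ∷ []) q t ÷₀ gFun (suc c ∷ la) ga q t) ≡ 1ℚ)
proposition6p8 la (decreasing , _) ga c λ₁≤c+1 =
  (1ℚ ÷₀ ½ , ½ , gFun-≢0 (suc c ∷ la) ga) ,
  λ q t t≢0 _ _ → gFun-shift c ga q t (parts≤head la decreasing λ₁≤c+1) t≢0
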